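{- Let $p,q,s,k\ge 1$ be integers with $p,q,s$ of the same odd-even parity. Then $$c^{(s)}_{p,q,k}=\sum_{i,j\ge 0}\binom{p}{2i}(2i-1)!!\,\binom{q}{2j}(2j-1)!!\; m^{(s)}_{p-2i,\,q-2j,\,k},$$ where $c^{(s)}_{p,q,k}$ is the number of canonical paired arrays in $\mathcal{PA}^{(s)}_{p,q,k}$ and $m^{(s)}_{p',q',k}$ is the number of minimal canonical paired arrays in $\mathcal{PA}^{(s)}_{p',q',k}$ (taken to be $0$ when no such arrays exist, e.g. when $p'<s$ or $q'<s$).
   Context: For integers $p,q,s,k\ge 1$ with $p,q,s$ of the same parity, $\mathcal{PA}^{(s)}_{p,q,k}$ is the set of paired arrays defined as follows. A paired array is an array of cells in $2$ rows and $k$ columns (columns indexed $1,\ldots,k$ left to right), where each cell contains a finite (possibly empty) ordered list of vertices, with $p$ vertices in total in row $1$ and $q$ in row $2$; the vertices are perfectly matched into pairs, exactly $s$ of which are mixed (one vertex in row 1, one in row 2). Conditions: (Balance) for every column $c$, the number of mixed pairs with a vertex in row 1 column $c$ equals the number with a vertex in row 2 column $c$. (Marking/nonempty) a nonempty set $R$ of columns has its row-1 cell marked and a nonempty set $R'$ of columns has its row-2 cell marked; every column not in $R\cup R'$ contains at least one vertex. (Forest) Let $D$ (resp. $D'$) be the set of columns whose row-1 (resp. row-2) cell is nonempty. For $c\in D\setminus R$ let $\psi(c)$ be the column of the vertex paired with the rightmost vertex of the row-1 cell of column $c$; the directed graph on vertex set $D\cup R$ with arcs $c\to\psi(c)$,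 $c\in D\setminus R$, must be a forest of $|R|$ trees, each containing exactly one element of $R$ with all arcs directed towards it. Analogously for row 2 with $D',R',\psi'$. Paired arrays are counted as combinatorial structures (cell contents sizes and orders, matching, markings). A paired array is canonical if $|R|=|R'|=1$. A redundant pair is a pair that is not mixed and neither of whose vertices is the rightmost vertex in an unmarked cell; a paired array is minimal if it has no redundant pair. $(2i-1)!!=\prod_{t=1}^{i}(2t-1)$, with $(-1)!!=1$. -}

module Defs where

open import Data.Nat using (ℕ; zero; suc; _+_; _*_; _∸_; _≤_; _<_; _≤ᵇ_; _<ᵇ_)
open import Data.Bool using (Bool; true; false; _∧_)
open import Data.Fin using (Fin; toℕ)
open import Data.Fin.Subset using (Subset; _∈_; _∉_; ∣_∣; Nonempty)
open import Data.Vec using (Vec; []; _∷_; lookup; tabulate; sum)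
open import Data.Sum using (_⊎_; inj₁; inj₂)
open import Data.Product using (Σ; ∃; _×_)
open import Data.List using (List; length; upTo; map)
open import Data.Nat.ListAction using () renaming (sum to lsum)
open import Data.List.Relation.Unary.All using (All)
open import Data.List.Relation.Unary.Unique.Propositional using (Unique)
open import Data.List.Membership.Propositional using () renaming (_∈_ to _∈ₗ_)
open import Relation.Binary.PropositionalEquality using (_≡_; _≢_)

-- double factorial (2i-1)!! = ∏_{t=1}^{i} (2t-1), with (-1)!! = 1
dfact : ℕ → ℕ
dfact zero    = 1
dfact (suc i) = (1 + 2 * i) * dfact i

sumUpTo : ℕ → (ℕ → ℕ) → ℕ
sumUpTo n f = lsum (map f (upTo (suc n)))

IsCount : {A : Set} → ℕ → (A → Set) → Set
IsCount {A} n P =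
  Σ (List A) λ xs → length xs ≡ n × Unique xs × All P xs × (∀ x → P x → x ∈ₗ xs)

-- Raw data of a 2 × k array with p vertices in row 1, q in row 2.
-- Vertices of row 1 are Fin p, numbered left to right (by column, then
-- by position inside the cell); similarly Fin q for row 2.
-- sz1 / sz2 : number of vertices in each cell of row 1 / row 2.
-- m1 / m2   : partner of each row-1 / row-2 vertex (inj₁ = row 1, inj₂ = row 2).
-- R / R'    : marked columns in row 1 / row 2.

Vertex : ℕ → ℕ → Set
Vertex p q = Fin p ⊎ Fin q

record Raw (p q k : ℕ) : Set where
  constructor mkRaw
  field
    sz1 : Vec ℕ k
    sz2 : Vec ℕ k
    m1  : Vec (Vertex p q) p
    m2  : Vec (Vertex p q) q
    R   : Subset k
    R'  : Subset k

cum : ∀ {k} → Vec ℕ k → Fin k → ℕ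
cum (x ∷ xs) Fin.zero    = 0
cum (x ∷ xs) (Fin.suc c) = x + cum xs c

InCell : ∀ {n k} → Vec ℕ k → Fin n → Fin k → Set
InCell sz i c = cum sz c ≤ toℕ i × toℕ i < cum sz c + lookup sz c

inCellᵇ : ∀ {n k} → Vec ℕ k → Fin n → Fin k → Bool
inCellᵇ sz i c = (cum sz c ≤ᵇ toℕ i) ∧ (toℕ i <ᵇ cum sz c + lookup sz c)

Rightmost : ∀ {n k} → Vec ℕ k → Fin n → Fin k → Set
Rightmost sz i c = InCell sz i c × suc (toℕ i) ≡ cum sz c + lookup sz c

isRow1 : ∀ {p q} → Vertex p q → Bool
isRow1 (inj₁ _) = true
isRow1 (inj₂ _) = false

isRow2 : ∀ {p q} → Vertex p q → Bool
isRow2 (inj₁ _) = false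
isRow2 (inj₂ _) = true

SameRow : ∀ {p q} → Vertex p q → Vertex p q → Set
SameRow v w = isRow1 v ≡ isRow1 w

module _ {p q k : ℕ} (A : Raw p q k) where
  open Raw A

  partner : Vertex p q → Vertex p q
  partner (inj₁ i) = lookup m1 i
  partner (inj₂ j) = lookup m2 j

  ColOf : Vertex p q → Fin k → Set
  ColOf (inj₁ i) c = InCell sz1 i c
  ColOf (inj₂ j) c = InCell sz2 j c

  mixedCount : ℕ
  mixedCount = ∣ tabulate (λ i → isRow2 (lookup m1 i)) ∣

  mixedIn1 : Fin k → ℕ
  mixedIn1 c = ∣ tabulate (λ i → inCellᵇ sz1 i c ∧ isRow2 (lookup m1 i)) ∣

  mixedIn2 : Fin k → ℕ
  mixedIn2 c = ∣ tabulate (λ j → inCellᵇ sz2 j c ∧ isRow1 (lookup m2 j)) ∣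

  Arc1 : Fin k → Fin k → Set
  Arc1 c d = c ∉ R × ∃ λ (i : Fin p) → Rightmost sz1 i c × ColOf (partner (inj₁ i)) d

  Arc2 : Fin k → Fin k → Set
  Arc2 c d = c ∉ R' × ∃ λ (j : Fin q) → Rightmost sz2 j c × ColOf (partner (inj₂ j)) d

-- following the (functional) arcs from c one reaches a root in Rt,
-- passing only through vertices of the graph (roots or nonempty
-- unmarked columns, which are exactly those having an outgoing arc)
data Reaches {k : ℕ} (Rt : Subset k) (Arc : Fin k → Fin k → Set) : Fin k → Set where
  root : ∀ {c} → c ∈ Rt → Reaches Rt Arc c
  step : ∀ {c d} → Arc c d → Reaches Rt Arc d → Reaches Rt Arc c

record IsPairedArray (p q s k : ℕ) (A : Raw p q k) : Set where
  open Raw A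
  field
    rowSum1    : sum sz1 ≡ p
    rowSum2    : sum sz2 ≡ q
    involutive : ∀ v → partner A (partner A v) ≡ v
    noFixed    : ∀ v → partner A v ≢ v
    mixed      : mixedCount A ≡ s
    balance    : ∀ c → mixedIn1 A c ≡ mixedIn2 A c
    markedR    : Nonempty R
    markedR'   : Nonempty R'
    nonempty   : ∀ c → c ∉ R → c ∉ R' → 1 ≤ lookup sz1 c + lookup sz2 c
    -- forest conditions: every vertex of D ∪ R (resp. D' ∪ R') is led to
    -- a root by the arcs; R-vertices are the roots
    forest1    : ∀ c → 1 ≤ lookup sz1 c → Reaches R (Arc1 A) c
    forest2    : ∀ c → 1 ≤ lookup sz2 c → Reaches R' (Arc2 A) c

Canonical : (p q s k : ℕ) → Raw p q k → Set
Canonical p q s k A = IsPairedArray p q s k A × ∣ Raw.R A ∣ ≡ 1 × ∣ Raw.R' A ∣ ≡ 1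

RightmostUnmarked : ∀ {p q k} → Raw p q k → Vertex p q → Set
RightmostUnmarked A (inj₁ i) = ∃ λ c → Rightmost (Raw.sz1 A) i c × c ∉ Raw.R A
RightmostUnmarked A (inj₂ j) = ∃ λ c → Rightmost (Raw.sz2 A) j c × c ∉ Raw.R' A

Redundant : ∀ {p q k} → Raw p q k → Vertex p q → Set
Redundant A v = SameRow v (partner A v)
              × (RightmostUnmarked A v → Data.Empty.⊥)
              × (RightmostUnmarked A (partner A v) → Data.Empty.⊥)
  where import Data.Empty

Minimal : ∀ {p q k} → Raw p q k → Set
Minimal A = ∀ v → Redundant A v → Data.Empty.⊥
  where import Data.Empty

MinCanonical : (p q s k : ℕ) → Raw p q k → Set
MinCanonical p q s k A = Canonical p q s k A × Minimal A

module Submission where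

-- A canonical array arises from a unique minimal one by inserting redundant
-- pairs, and we remove them one row at a time.  In row 1 the vertices are
-- ordered by a cyclic key starting right after the (unique) marked cell.  Let
-- Clean t be the arrays with no redundant row-1 pair through a vertex of key
-- < t.  Then Clean t = Clean (t+1) ⊎ RedAt t, where RedAt t has a redundant
-- pair through the vertex of key t; removing that pair is a bijection from
-- RedAt t (with n+2 row-1 vertices) onto Clean t (with n vertices) times the
-- n+1-t possible keys of the partner.  This recurrence is solved by the closed
-- form Σ_i (d C 2i)(2i-1)!! N(p-2i) (Pascal's rule and absorption).  Row 2 is
-- handled by the same result applied to the row-swapped arrays, and the two
-- closed forms nest into the double sum.  Only k ≥ 1 (a marked column exists)
-- is used.

open import Defs
open import Data.Nat
open import Data.Nat.Properties
open import Data.Nat.Combinatorics using (_C_; nCk+nC[k+1]≡[n+1]C[k+1]; k>n⇒nCk≡0; nC1≡n)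
open import Data.Nat.ListAction using () renaming (sum to lsum)
open import Data.Nat.Tactic.RingSolver using (solve-∀)
open import Data.Bool using (Bool; true; false; _∧_; T)
open import Data.Bool.Properties using (∧-zeroʳ) renaming (_≟_ to _≟B_)
open import Data.Fin using (Fin; zero; suc; toℕ; punchIn; punchOut; fromℕ<)
open import Data.Fin.Properties using (toℕ-injective; toℕ<n; toℕ-fromℕ<; punchIn-punchOut; punchInᵢ≢i; punchIn-injective; punchOut-cong; punchOut-punchIn; any?) renaming (_≟_ to _≟F_; suc-injective to Fsuc-injective)
open import Data.Fin.Subset using (Subset; _∈_; _∉_; ∣_∣; Nonempty)
open import Data.Fin.Subset.Properties using (_∈?_)
open import Data.Vec using (Vec; []; _∷_; lookup; sum; tabulate; head; tail; here; there) renaming (map to vmap)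
open import Data.Vec.Properties using (tabulate-cong; lookup∘tabulate; tabulate∘lookup; lookup-map; map-∘; map-cong; map-id)
open import Data.List using (List; []; _∷_; length; _++_; map; applyUpTo)
open import Data.List.Properties using (length-map; length-++)
open import Data.List.Relation.Unary.All using (All; []; _∷_) renaming (lookup to All-lookup; map to All-map; tabulate to All-tabulate)
open import Data.List.Relation.Unary.All.Properties using (map⁺; ++⁺)
open import Data.List.Relation.Unary.Unique.Propositional using (Unique)
open import Data.List.Relation.Unary.AllPairs using ([]; _∷_)
open import Data.List.Relation.Unary.Any using (here; there)
open import Data.List.Membership.Propositional using () renaming (_∈_ to _∈ₗ_)
open import Data.List.Membership.Propositional.Properties using (∈-map⁺; ∈-++⁺ˡ; ∈-++⁺ʳ)
open import Data.Product using (Σ; _×_; _,_; proj₁; proj₂)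
open import Data.Sum using (_⊎_; inj₁; inj₂) renaming ([_,_] to either)
open import Data.Sum.Properties using (inj₁-injective; inj₂-injective)
open import Data.Empty using (⊥; ⊥-elim)
open import Data.Unit using (tt)
open import Relation.Nullary using (¬_; yes; no; Dec)
open import Relation.Nullary.Decidable using (_×-dec_; ¬?)
open import Relation.Binary using (tri<; tri≈; tri>)
open import Relation.Binary.PropositionalEquality

module Counting where
  private
    remove : ∀ {A : Set} {x : A} (ys : List A) → x ∈ₗ ys → List A
    remove (y ∷ ys) (here _)  = ys
    remove (y ∷ ys) (there p) = y ∷ remove ys p

    length-remove : ∀ {A : Set} {x : A} (ys : List A) (p : x ∈ₗ ys) →
      suc (length (remove ys p)) ≡ length ys
    length-remove (y ∷ ys) (here _)  = refl
    length-remove (y ∷ ys) (there p) = cong suc (length-remove ys p)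

    ∈-remove : ∀ {A : Set} {x z : A} {ys : List A} → z ∈ₗ ys → z ≢ x → (p : x ∈ₗ ys) →
      z ∈ₗ remove ys p
    ∈-remove (here refl) z≢x (here refl) = ⊥-elim (z≢x refl)
    ∈-remove (there z∈)  z≢x (here refl) = z∈
    ∈-remove (here refl) z≢x (there p)   = here refl
    ∈-remove (there z∈)  z≢x (there p)   = there (∈-remove z∈ z≢x p)

  unique-sublist-length : ∀ {A : Set} {xs ys : List A} → Unique xs →
    (∀ z → z ∈ₗ xs → z ∈ₗ ys) → length xs ≤ length ys
  unique-sublist-length {xs = []} _ _ = z≤n
  unique-sublist-length {xs = x ∷ xs} {ys} (x∉xs ∷ u) xs⊆ys =
    subst (suc (length xs) ≤_) (length-remove ys x∈ys)
      (s≤s (unique-sublist-length u (λ z z∈ →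
        ∈-remove (xs⊆ys z (there z∈)) (λ z≡x → All-lookup x∉xs z∈ (sym z≡x)) x∈ys)))
    where
    x∈ys : x ∈ₗ ys
    x∈ys = xs⊆ys x (here refl)

  IC-unique : ∀ {A : Set} {P : A → Set} {a b : ℕ} → IsCount a P → IsCount b P → a ≡ b
  IC-unique (xs , lx , ux , ax , cx) (ys , ly , uy , ay , cy) =
    ≤-antisym (subst₂ _≤_ lx ly (unique-sublist-length ux (λ z z∈ → cy z (All-lookup ax z∈))))
              (subst₂ _≤_ ly lx (unique-sublist-length uy (λ z z∈ → cx z (All-lookup ay z∈))))

  IC-⇔ : ∀ {A : Set} {P Q : A → Set} {a : ℕ} → IsCount a P →
    (∀ x → P x → Q x) → (∀ x → Q x → P x) → IsCount a Q
  IC-⇔ (xs , lx , ux , ax , cx) P⇒Q Q⇒P =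
    xs , lx , ux , All-map (λ {x} → P⇒Q x) ax , (λ x qx → cx x (Q⇒P x qx))

  IC-≡ : ∀ {A : Set} {P : A → Set} {a b : ℕ} → a ≡ b → IsCount a P → IsCount b P
  IC-≡ refl c = c

  IC-empty : ∀ {A : Set} {P : A → Set} → (∀ x → P x → ⊥) → IsCount 0 P
  IC-empty no-solution = [] , refl , [] , [] , (λ x px → ⊥-elim (no-solution x px))

  private
    unique-map : ∀ {A B : Set} {P : A → Set} (f : A → B) {xs : List A} → Unique xs → All P xs →
      (∀ x x' → P x → P x' → f x ≡ f x' → x ≡ x') → Unique (map f xs)
    unique-map f [] [] f-inj = []
    unique-map {P = P} f {x ∷ xs} (x∉xs ∷ u) (px ∷ pxs) f-inj =
      map⁺ (distinct xs x∉xs pxs) ∷ unique-map f u pxs f-inj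
      where
      distinct : ∀ ys → All (λ y → x ≢ y) ys → All P ys → All (λ y → f x ≢ f y) ys
      distinct [] [] [] = []
      distinct (y ∷ ys) (x≢y ∷ ns) (py ∷ pys) =
        (λ e → x≢y (f-inj x y px py e)) ∷ distinct ys ns pys

    unique-++ : ∀ {A : Set} {xs ys : List A} → Unique xs → Unique ys →
      (∀ z → z ∈ₗ xs → z ∈ₗ ys → ⊥) → Unique (xs ++ ys)
    unique-++ {xs = []} ux uy disjoint = uy
    unique-++ {xs = x ∷ xs} {ys} (x∉xs ∷ ux) uy disjoint =
      ++⁺ x∉xs (All-tabulate (λ {z} z∈ x≡z → disjoint x (here refl) (subst (_∈ₗ ys) (sym x≡z) z∈))) ∷
      unique-++ ux uy (λ z z∈xs z∈ys → disjoint z (there z∈xs) z∈ys)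

  IC-bij : ∀ {A B : Set} {P : A → Set} {Q : B → Set} {a : ℕ} → IsCount a P → (f : A → B) →
    (∀ x → P x → Q (f x)) → (∀ x x' → P x → P x' → f x ≡ f x' → x ≡ x') →
    (∀ y → Q y → Σ A (λ x → P x × f x ≡ y)) → IsCount a Q
  IC-bij (xs , lx , ux , ax , cx) f pres inj surj =
    map f xs , trans (length-map f xs) lx , unique-map f ux ax inj ,
    map⁺ (All-map (λ {x} → pres x) ax) ,
    (λ y qy → let (x , px , fx≡y) = surj y qy in subst (_∈ₗ map f xs) fx≡y (∈-map⁺ f (cx x px)))

  IC-⊎ : ∀ {A : Set} {P Q : A → Set} {a b : ℕ} → IsCount a P → IsCount b Q →
    (∀ x → P x → Q x → ⊥) → IsCount (a + b) (λ x → P x ⊎ Q x)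
  IC-⊎ (xs , lx , ux , ax , cx) (ys , ly , uy , ay , cy) disjoint =
    xs ++ ys , trans (length-++ xs) (cong₂ _+_ lx ly) ,
    unique-++ ux uy (λ z z∈xs z∈ys → disjoint z (All-lookup ax z∈xs) (All-lookup ay z∈ys)) ,
    ++⁺ (All-map inj₁ ax) (All-map inj₂ ay) ,
    λ { x (inj₁ px) → ∈-++⁺ˡ (cx x px) ; x (inj₂ qx) → ∈-++⁺ʳ xs (cy x qx) }

  IC-×Fin : ∀ {A : Set} {P : A → Set} {a : ℕ} → IsCount a P → (m : ℕ) →
    IsCount (a * m) (λ (xj : A × Fin m) → P (proj₁ xj))
  IC-×Fin {a = a} c zero = IC-≡ (sym (*-zeroʳ a)) (IC-empty (λ { (_ , ()) _ }))
  IC-×Fin {A = A} {P} {a} c (suc m) =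
    IC-≡ (sym (*-suc a m)) (IC-⇔ (IC-⊎ atZero atSuc disjoint) forget split)
    where
    AtZero AtSuc : A × Fin (suc m) → Set
    AtZero (x , j) = P x × j ≡ zero
    AtSuc  (x , j) = P x × Σ (Fin m) (λ j' → j ≡ suc j')

    atZero : IsCount a AtZero
    atZero = IC-bij c (λ x → x , zero) (λ x px → px , refl) (λ x x' _ _ e → cong proj₁ e)
               (λ { (x , .zero) (px , refl) → x , px , refl })

    atSuc : IsCount (a * m) AtSuc
    atSuc = IC-bij (IC-×Fin c m) (λ { (x , j) → x , suc j }) (λ { (x , j) px → px , j , refl })
              (λ { (x , j) (x' , j') _ _ refl → refl })
              (λ { (x , .(suc j)) (px , j , refl) → (x , j) , px , refl })

    disjoint : ∀ xj → AtZero xj → AtSuc xj → ⊥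
    disjoint (x , .zero) (_ , refl) (_ , j , ())

    forget : ∀ xj → AtZero xj ⊎ AtSuc xj → P (proj₁ xj)
    forget xj (inj₁ (px , _)) = px
    forget xj (inj₂ (px , _)) = px

    split : ∀ xj → P (proj₁ xj) → AtZero xj ⊎ AtSuc xj
    split (x , zero)  px = inj₁ (px , refl)
    split (x , suc j) px = inj₂ (px , j , refl)

  private
    TrueAtSuc : ∀ {n} → (Fin (suc n) → Bool) → Fin (suc n) → Set
    TrueAtSuc {n} f i = Σ (Fin n) (λ i' → i ≡ suc i' × f i ≡ true)

    split-suc : ∀ {n} (f : Fin (suc n) → Bool) (i : Fin n) → f (suc i) ≡ true → TrueAtSuc f (suc i)
    split-suc f i e = i , refl , e

  IC-subset : ∀ {n} (f : Fin n → Bool) → IsCount ∣ tabulate f ∣ (λ i → f i ≡ true)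

  IC-subset-tail : ∀ {n} (f : Fin (suc n) → Bool) →
    IsCount ∣ tabulate (λ i → f (suc i)) ∣ (TrueAtSuc f)

  IC-subset {zero} f = IC-empty (λ ())
  IC-subset {suc n} f with f zero in f0≡
  ... | true  = IC-⇔ (IC-⊎ onlyZero (IC-subset-tail f) disjoint) merge split
    where
    onlyZero : IsCount 1 (_≡ zero)
    onlyZero = zero ∷ [] , refl , [] ∷ [] , refl ∷ [] , (λ { .zero refl → here refl })

    disjoint : ∀ i → i ≡ zero → TrueAtSuc f i → ⊥
    disjoint .zero refl (_ , () , _)

    merge : ∀ i → i ≡ zero ⊎ TrueAtSuc f i → f i ≡ true
    merge .zero (inj₁ refl)        = f0≡
    merge i     (inj₂ (_ , _ , e)) = e

    split : ∀ i → f i ≡ true → i ≡ zero ⊎ TrueAtSuc f i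
    split zero    _ = inj₁ refl
    split (suc i) e = inj₂ (split-suc f i e)
  ... | false = IC-⇔ (IC-subset-tail f) (λ i (_ , _ , e) → e) split
    where
    split : ∀ i → f i ≡ true → TrueAtSuc f i
    split zero    e with trans (sym f0≡) e
    ... | ()
    split (suc i) e = split-suc f i e

  IC-subset-tail f = IC-bij (IC-subset (λ i → f (suc i))) suc (λ i e → i , refl , e)
                (λ i i' _ _ → Fsuc-injective) (λ { .(suc i') (i' , refl , e) → i' , e , refl })

module CellLayout where
  lt-or-ge : ∀ m n → m < n ⊎ n ≤ m
  lt-or-ge m n with n ≤? m
  ... | yes n≤m = inj₂ n≤m
  ... | no  n≰m = inj₁ (≰⇒> n≰m)

  End : ∀ {k} → Vec ℕ k → Fin k → ℕ
  End sz c = cum sz c + lookup sz c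

  End-le-cum : ∀ {k} (sz : Vec ℕ k) (c c' : Fin k) → toℕ c < toℕ c' → End sz c ≤ cum sz c'
  End-le-cum (x ∷ xs) zero (suc c') _ = m≤m+n x (cum xs c')
  End-le-cum (x ∷ xs) (suc c) (suc c') (s≤s c<c') =
    subst (_≤ x + cum xs c') (sym (+-assoc x (cum xs c) (lookup xs c)))
      (+-monoʳ-≤ x (End-le-cum xs c c' c<c'))

  cum-le-End : ∀ {k} (sz : Vec ℕ k) (c : Fin k) → cum sz c ≤ End sz c
  cum-le-End sz c = m≤m+n _ _

  cum-mono : ∀ {k} (sz : Vec ℕ k) (c c' : Fin k) → toℕ c ≤ toℕ c' → cum sz c ≤ cum sz c'
  cum-mono sz c c' c≤c' with m≤n⇒m<n∨m≡n c≤c'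
  ... | inj₁ c<c' = ≤-trans (cum-le-End sz c) (End-le-cum sz c c' c<c')
  ... | inj₂ c≡c' rewrite toℕ-injective c≡c' = ≤-refl

  End-mono : ∀ {k} (sz : Vec ℕ k) (c c' : Fin k) → toℕ c ≤ toℕ c' → End sz c ≤ End sz c'
  End-mono sz c c' c≤c' with m≤n⇒m<n∨m≡n c≤c'
  ... | inj₁ c<c' = ≤-trans (End-le-cum sz c c' c<c') (cum-le-End sz c')
  ... | inj₂ c≡c' rewrite toℕ-injective c≡c' = ≤-refl

  End-le-sum : ∀ {k} (sz : Vec ℕ k) (c : Fin k) → End sz c ≤ sum sz
  End-le-sum (x ∷ xs) zero    = m≤m+n x (sum xs)
  End-le-sum (x ∷ xs) (suc c) =
    subst (_≤ x + sum xs) (sym (+-assoc x (cum xs c) (lookup xs c))) (+-monoʳ-≤ x (End-le-sum xs c))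

  position-cell-unique : ∀ {k} (sz : Vec ℕ k) X (c c' : Fin k) →
    cum sz c ≤ X × X < End sz c → cum sz c' ≤ X × X < End sz c' → c ≡ c'
  position-cell-unique sz X c c' (l , h) (l' , h') with <-cmp (toℕ c) (toℕ c')
  ... | tri≈ _ c≡c' _ = toℕ-injective c≡c'
  ... | tri< c<c' _ _ = ⊥-elim (<⇒≱ h (≤-trans (End-le-cum sz c c' c<c') l'))
  ... | tri> _ _ c>c' = ⊥-elim (<⇒≱ h' (≤-trans (End-le-cum sz c' c c>c') l))

  InCell-unique : ∀ {n k} (sz : Vec ℕ k) (i : Fin n) (c c' : Fin k) →
    InCell sz i c → InCell sz i c' → c ≡ c'
  InCell-unique sz i = position-cell-unique sz (toℕ i)

  InCell⇒nonempty : ∀ {n k} (sz : Vec ℕ k) (i : Fin n) c → InCell sz i c → 1 ≤ lookup sz c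
  InCell⇒nonempty sz i c (l , h) with lookup sz c
  ... | zero  = ⊥-elim (<⇒≱ h (subst (_≤ toℕ i) (sym (+-identityʳ _)) l))
  ... | suc _ = s≤s z≤n

  nonempty⇒rightmost : ∀ {n k} (sz : Vec ℕ k) → sum sz ≡ n → (c : Fin k) → 1 ≤ lookup sz c →
    Σ (Fin n) (λ i → Rightmost sz i c)
  nonempty⇒rightmost {n} sz sum≡n c _ with lookup sz c in sz[c]≡
  ... | suc m = fromℕ< last<n , (first≤last , last<end) , sym end≡
    where
    end≡ : cum sz c + suc m ≡ suc (toℕ (fromℕ< _))
    end≡ = trans (+-suc (cum sz c) m) (cong suc (sym (toℕ-fromℕ< _)))
    last<n : cum sz c + m < n
    last<n = subst (cum sz c + m <_) sum≡n
      (subst (_≤ sum sz) (trans (cong (cum sz c +_) sz[c]≡) (+-suc (cum sz c) m)) (End-le-sum sz c))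
    first≤last : cum sz c ≤ toℕ (fromℕ< last<n)
    first≤last = subst (cum sz c ≤_) (sym (toℕ-fromℕ< last<n)) (m≤m+n _ _)
    last<end : toℕ (fromℕ< last<n) < cum sz c + suc m
    last<end = subst (toℕ (fromℕ< last<n) <_) (sym end≡) (n<1+n _)

  colOf : ∀ {k} → Vec ℕ (suc k) → ℕ → Fin (suc k)
  colOf (s ∷ []) X = zero
  colOf (s ∷ s' ∷ ss) X with X <? s
  ... | yes _ = zero
  ... | no  _ = suc (colOf (s' ∷ ss) (X ∸ s))

  ∸-<-split : ∀ m a b → m < a + b → a ≤ m → m ∸ a < b
  ∸-<-split m a b m<a+b a≤m = +-cancelˡ-< a (m ∸ a) b (subst (_< a + b) (sym (m+[n∸m]≡n a≤m)) m<a+b)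

  colOf-cell : ∀ {k} (sz : Vec ℕ (suc k)) X → X < sum sz →
    cum sz (colOf sz X) ≤ X × X < End sz (colOf sz X)
  colOf-cell (s ∷ []) X X<sum = z≤n , subst (X <_) (+-identityʳ s) X<sum
  colOf-cell (s ∷ s' ∷ ss) X X<sum with X <? s
  ... | yes X<s = z≤n , X<s
  ... | no  X≮s with colOf-cell (s' ∷ ss) (X ∸ s) (∸-<-split X s _ X<sum (≮⇒≥ X≮s))
  ...   | l , h = subst (s + cum (s' ∷ ss) (colOf (s' ∷ ss) (X ∸ s)) ≤_) (m+[n∸m]≡n (≮⇒≥ X≮s)) (+-monoʳ-≤ s l) ,
                  subst₂ _<_ (m+[n∸m]≡n (≮⇒≥ X≮s)) (sym (+-assoc s _ _)) (+-monoʳ-< s h)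

  colOf-unique : ∀ {k} (sz : Vec ℕ (suc k)) X c → cum sz c ≤ X → X < End sz c → X < sum sz →
    colOf sz X ≡ c
  colOf-unique sz X c l h X<sum = position-cell-unique sz X _ c (colOf-cell sz X X<sum) (l , h)

  incr : ∀ {k} → Fin k → Vec ℕ k → Vec ℕ k
  incr zero    (x ∷ xs) = suc x ∷ xs
  incr (suc c) (x ∷ xs) = x ∷ incr c xs

  decr : ∀ {k} → Fin k → Vec ℕ k → Vec ℕ k
  decr zero    (x ∷ xs) = pred x ∷ xs
  decr (suc c) (x ∷ xs) = x ∷ decr c xs

  incr-decr : ∀ {k} (c : Fin k) (sz : Vec ℕ k) → 1 ≤ lookup sz c → incr c (decr c sz) ≡ sz
  incr-decr zero    (suc x ∷ xs) _ = refl
  incr-decr (suc c) (x ∷ xs) h = cong (x ∷_) (incr-decr c xs h)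

  incr-injective : ∀ {k} (c : Fin k) (sz sz' : Vec ℕ k) → incr c sz ≡ incr c sz' → sz ≡ sz'
  incr-injective zero    (x ∷ xs) (y ∷ ys) refl = refl
  incr-injective (suc c) (x ∷ xs) (y ∷ ys) e =
    cong₂ _∷_ (cong head e) (incr-injective c xs ys (cong tail e))

  lookup-incr-same : ∀ {k} (c : Fin k) (sz : Vec ℕ k) → lookup (incr c sz) c ≡ suc (lookup sz c)
  lookup-incr-same zero    (x ∷ xs) = refl
  lookup-incr-same (suc c) (x ∷ xs) = lookup-incr-same c xs

  lookup-incr-other : ∀ {k} (c0 c : Fin k) (sz : Vec ℕ k) → c ≢ c0 → lookup (incr c0 sz) c ≡ lookup sz c
  lookup-incr-other zero    zero    (x ∷ xs) c≢c0 = ⊥-elim (c≢c0 refl)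
  lookup-incr-other zero    (suc c) (x ∷ xs) _    = refl
  lookup-incr-other (suc c0) zero   (x ∷ xs) _    = refl
  lookup-incr-other (suc c0) (suc c) (x ∷ xs) c≢c0 = lookup-incr-other c0 c xs (λ e → c≢c0 (cong suc e))

  cum-incr-le : ∀ {k} (c0 c : Fin k) (sz : Vec ℕ k) → toℕ c ≤ toℕ c0 → cum (incr c0 sz) c ≡ cum sz c
  cum-incr-le zero     zero    (x ∷ xs) _ = refl
  cum-incr-le (suc c0) zero    (x ∷ xs) _ = refl
  cum-incr-le (suc c0) (suc c) (x ∷ xs) (s≤s c≤c0) = cong (x +_) (cum-incr-le c0 c xs c≤c0)

  cum-incr-gt : ∀ {k} (c0 c : Fin k) (sz : Vec ℕ k) → toℕ c0 < toℕ c → cum (incr c0 sz) c ≡ suc (cum sz c)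
  cum-incr-gt zero     (suc c) (x ∷ xs) _ = refl
  cum-incr-gt (suc c0) (suc c) (x ∷ xs) (s≤s c0<c) = trans (cong (x +_) (cum-incr-gt c0 c xs c0<c)) (+-suc x _)

  sum-incr : ∀ {k} (c0 : Fin k) (sz : Vec ℕ k) → sum (incr c0 sz) ≡ suc (sum sz)
  sum-incr zero     (x ∷ xs) = refl
  sum-incr (suc c0) (x ∷ xs) = trans (cong (x +_) (sum-incr c0 xs)) (+-suc x _)

  End-incr-lt : ∀ {k} (c0 c : Fin k) (sz : Vec ℕ k) → toℕ c < toℕ c0 → End (incr c0 sz) c ≡ End sz c
  End-incr-lt c0 c sz c<c0 = cong₂ _+_ (cum-incr-le c0 c sz (<⇒≤ c<c0))
    (lookup-incr-other c0 c sz (λ e → <-irrefl (cong toℕ e) c<c0))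

  End-incr-ge : ∀ {k} (c0 c : Fin k) (sz : Vec ℕ k) → toℕ c0 ≤ toℕ c → End (incr c0 sz) c ≡ suc (End sz c)
  End-incr-ge c0 c sz c0≤c with m≤n⇒m<n∨m≡n c0≤c
  ... | inj₁ c0<c = cong₂ _+_ (cum-incr-gt c0 c sz c0<c)
                      (lookup-incr-other c0 c sz (λ e → <-irrefl (cong toℕ (sym e)) c0<c))
  ... | inj₂ c0≡c rewrite toℕ-injective c0≡c =
    trans (cong₂ _+_ (cum-incr-le c c sz ≤-refl) (lookup-incr-same c sz)) (+-suc _ _)

  toℕ-punchIn-< : ∀ {n} (x : Fin (suc n)) (y : Fin n) → toℕ y < toℕ x → toℕ (punchIn x y) ≡ toℕ y
  toℕ-punchIn-< (suc x) zero    _ = refl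
  toℕ-punchIn-< (suc x) (suc y) (s≤s y<x) = cong suc (toℕ-punchIn-< x y y<x)

  toℕ-punchIn-≥ : ∀ {n} (x : Fin (suc n)) (y : Fin n) → toℕ x ≤ toℕ y → toℕ (punchIn x y) ≡ suc (toℕ y)
  toℕ-punchIn-≥ zero    y _ = refl
  toℕ-punchIn-≥ (suc x) (suc y) (s≤s x≤y) = cong suc (toℕ-punchIn-≥ x y x≤y)

  -- Position x (in the row after insertion) is a legal place for a new vertex
  -- in the cell of column c0: it lies between the start and the end of that cell.
  record ValidIns {k n : ℕ} (sz : Vec ℕ k) (x : Fin (suc n)) (c0 : Fin k) : Set where
    constructor vi
    field
      lo : cum sz c0 ≤ toℕ x
      hi : toℕ x ≤ End sz c0

  -- Inserting a new vertex at position x into cell c0: the old vertex y becomes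
  -- `punchIn x y`.
  module Insertion {k n : ℕ} (sz : Vec ℕ k) (x : Fin (suc n)) (c0 : Fin k) (V : ValidIns sz x c0) where
    open ValidIns V

    sz' : Vec ℕ k
    sz' = incr c0 sz

    lo-fwd : ∀ (y : Fin n) c → cum sz c ≤ toℕ y → cum sz' c ≤ toℕ (punchIn x y)
    lo-fwd y c le with lt-or-ge (toℕ c0) (toℕ c) | lt-or-ge (toℕ y) (toℕ x)
    ... | inj₂ cle | inj₁ ylt rewrite cum-incr-le c0 c sz cle | toℕ-punchIn-< x y ylt = le
    ... | inj₂ cle | inj₂ yge rewrite cum-incr-le c0 c sz cle | toℕ-punchIn-≥ x y yge = m≤n⇒m≤1+n le
    ... | inj₁ cgt | inj₁ ylt = ⊥-elim (<⇒≱ ylt (≤-trans (≤-trans hi (End-le-cum sz c0 c cgt)) le))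
    ... | inj₁ cgt | inj₂ yge rewrite cum-incr-gt c0 c sz cgt | toℕ-punchIn-≥ x y yge = s≤s le

    lo-bwd : ∀ (y : Fin n) c → cum sz' c ≤ toℕ (punchIn x y) → cum sz c ≤ toℕ y
    lo-bwd y c le with lt-or-ge (toℕ c0) (toℕ c) | lt-or-ge (toℕ y) (toℕ x)
    ... | inj₂ cle | inj₁ ylt rewrite cum-incr-le c0 c sz cle | toℕ-punchIn-< x y ylt = le
    ... | inj₂ cle | inj₂ yge = ≤-trans (cum-mono sz c c0 cle) (≤-trans lo yge)
    ... | inj₁ cgt | inj₁ ylt rewrite cum-incr-gt c0 c sz cgt | toℕ-punchIn-< x y ylt =
          ⊥-elim (<⇒≱ (<-≤-trans ylt (≤-trans hi (End-le-cum sz c0 c cgt))) (≤-trans (n≤1+n _) le))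
    ... | inj₁ cgt | inj₂ yge rewrite cum-incr-gt c0 c sz cgt | toℕ-punchIn-≥ x y yge = ≤-pred le

    hi-fwd : ∀ (y : Fin n) c → toℕ y < End sz c → toℕ (punchIn x y) < End sz' c
    hi-fwd y c lt with lt-or-ge (toℕ c) (toℕ c0) | lt-or-ge (toℕ y) (toℕ x)
    ... | inj₁ clt | inj₁ ylt rewrite End-incr-lt c0 c sz clt | toℕ-punchIn-< x y ylt = lt
    ... | inj₁ clt | inj₂ yge = ⊥-elim (<⇒≱ lt (≤-trans (End-le-cum sz c c0 clt) (≤-trans lo yge)))
    ... | inj₂ cge | inj₁ ylt rewrite End-incr-ge c0 c sz cge | toℕ-punchIn-< x y ylt = m≤n⇒m≤1+n lt
    ... | inj₂ cge | inj₂ yge rewrite End-incr-ge c0 c sz cge | toℕ-punchIn-≥ x y yge = s≤s lt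

    hi-bwd : ∀ (y : Fin n) c → toℕ (punchIn x y) < End sz' c → toℕ y < End sz c
    hi-bwd y c lt with lt-or-ge (toℕ c) (toℕ c0) | lt-or-ge (toℕ y) (toℕ x)
    ... | inj₁ clt | inj₁ ylt rewrite End-incr-lt c0 c sz clt | toℕ-punchIn-< x y ylt = lt
    ... | inj₁ clt | inj₂ yge rewrite End-incr-lt c0 c sz clt | toℕ-punchIn-≥ x y yge = <-trans (n<1+n _) lt
    ... | inj₂ cge | inj₁ ylt = <-≤-trans ylt (≤-trans hi (End-mono sz c0 c cge))
    ... | inj₂ cge | inj₂ yge rewrite End-incr-ge c0 c sz cge | toℕ-punchIn-≥ x y yge = ≤-pred lt

    cell-fwd : ∀ (y : Fin n) c → InCell sz y c → InCell sz' (punchIn x y) c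
    cell-fwd y c (l , h) = lo-fwd y c l , hi-fwd y c h

    cell-bwd : ∀ (y : Fin n) c → InCell sz' (punchIn x y) c → InCell sz y c
    cell-bwd y c (l , h) = lo-bwd y c l , hi-bwd y c h

    cell-new : InCell sz' x c0
    cell-new = subst (_≤ toℕ x) (sym (cum-incr-le c0 c0 sz ≤-refl)) lo ,
               subst (toℕ x <_) (sym (End-incr-ge c0 c0 sz ≤-refl)) (s≤s hi)

    rm-bwd : ∀ (y : Fin n) c → Rightmost sz' (punchIn x y) c → Rightmost sz y c
    rm-bwd y c (ic , e) with cell-bwd y c ic
    ... | ic0@(l , h) with lt-or-ge (toℕ c) (toℕ c0) | lt-or-ge (toℕ y) (toℕ x)
    ... | inj₁ clt | inj₁ ylt rewrite End-incr-lt c0 c sz clt | toℕ-punchIn-< x y ylt = ic0 , e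
    ... | inj₁ clt | inj₂ yge = ⊥-elim (<⇒≱ h (≤-trans (End-le-cum sz c c0 clt) (≤-trans lo yge)))
    ... | inj₂ cge | inj₁ ylt rewrite End-incr-ge c0 c sz cge | toℕ-punchIn-< x y ylt =
          ⊥-elim (<-irrefl (suc-injective e) h)
    ... | inj₂ cge | inj₂ yge rewrite End-incr-ge c0 c sz cge | toℕ-punchIn-≥ x y yge = ic0 , suc-injective e

    rm-fwd : ∀ (y : Fin n) c → Rightmost sz y c → (c ≡ c0 → toℕ x ≡ End sz c0 → ⊥) →
      Rightmost sz' (punchIn x y) c
    rm-fwd y c (ic@(l , h) , e) not-appended = cell-fwd y c ic , end
      where
      end : suc (toℕ (punchIn x y)) ≡ End sz' c
      end with lt-or-ge (toℕ c) (toℕ c0) | lt-or-ge (toℕ y) (toℕ x)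
      ... | inj₁ clt | inj₁ ylt = trans (cong suc (toℕ-punchIn-< x y ylt)) (trans e (sym (End-incr-lt c0 c sz clt)))
      ... | inj₁ clt | inj₂ yge = ⊥-elim (<⇒≱ h (≤-trans (End-le-cum sz c c0 clt) (≤-trans lo yge)))
      ... | inj₂ cge | inj₂ yge = trans (cong suc (toℕ-punchIn-≥ x y yge)) (trans (cong suc e) (sym (End-incr-ge c0 c sz cge)))
      ... | inj₂ cge | inj₁ ylt with m≤n⇒m<n∨m≡n cge
      ...   | inj₁ c0lt = ⊥-elim (<⇒≱ (<-≤-trans ylt (≤-trans hi (End-le-cum sz c0 c c0lt))) l)
      ...   | inj₂ eq with toℕ-injective eq
      ...     | refl = ⊥-elim (not-appended refl (≤-antisym hi (subst (_≤ toℕ x) e ylt)))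

    rm-new : ∀ c → Rightmost sz' x c → c ≡ c0 × toℕ x ≡ End sz c0
    rm-new c (ic , e) with InCell-unique sz' x c c0 ic cell-new
    ... | refl = refl , suc-injective (trans e (End-incr-ge c0 c0 sz ≤-refl))

  valid-from-cell : ∀ {n k} (L : Vec ℕ k) (x : Fin (suc n)) c0 → InCell (incr c0 L) x c0 → ValidIns L x c0
  valid-from-cell L x c0 (l , h) =
    vi (subst (_≤ toℕ x) (cum-incr-le c0 c0 L ≤-refl) l)
       (≤-pred (subst (toℕ x <_) (End-incr-ge c0 c0 L ≤-refl) h))

  rm-at-end : ∀ {n k} (sz : Vec ℕ k) (x : Fin (suc n)) c0 (V : ValidIns sz x c0) →
    toℕ x ≡ End sz c0 → Rightmost (incr c0 sz) x c0
  rm-at-end sz x c0 V e = Insertion.cell-new sz x c0 V , trans (cong suc e) (sym (End-incr-ge c0 c0 sz ≤-refl))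

module CyclicKeys where
  open CellLayout

  -- The key of position X in a row of n positions, read cyclically starting
  -- right after position e (the end of the root cell): X ↦ (X - e) mod n.
  keyℕ : ℕ → ℕ → ℕ → ℕ
  keyℕ n e X with e ≤? X
  ... | yes _ = X ∸ e
  ... | no  _ = X + (n ∸ e)

  key-ge : ∀ n e X → e ≤ X → keyℕ n e X ≡ X ∸ e
  key-ge n e X e≤X with e ≤? X
  ... | yes _   = refl
  ... | no  e≰X = ⊥-elim (e≰X e≤X)

  key-lt : ∀ n e X → X < e → keyℕ n e X ≡ X + (n ∸ e)
  key-lt n e X X<e with e ≤? X
  ... | yes e≤X = ⊥-elim (<⇒≱ X<e e≤X)
  ... | no  _   = refl

  key-bound : ∀ n e X → X < n → e ≤ n → keyℕ n e X < n
  key-bound n e X X<n e≤n with lt-or-ge X e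
  ... | inj₁ X<e rewrite key-lt n e X X<e = subst (X + (n ∸ e) <_) (m+[n∸m]≡n e≤n) (+-monoˡ-< (n ∸ e) X<e)
  ... | inj₂ e≤X rewrite key-ge n e X e≤X = ≤-<-trans (m∸n≤m X e) X<n

  key-inj : ∀ n e X X' → X < n → X' < n → e ≤ n → keyℕ n e X ≡ keyℕ n e X' → X ≡ X'
  key-inj n e X X' X<n X'<n e≤n eq with lt-or-ge X e | lt-or-ge X' e
  ... | inj₁ a | inj₁ b rewrite key-lt n e X a | key-lt n e X' b = +-cancelʳ-≡ (n ∸ e) X X' eq
  ... | inj₂ a | inj₂ b rewrite key-ge n e X a | key-ge n e X' b =
        trans (sym (m∸n+n≡m a)) (trans (cong (_+ e) eq) (m∸n+n≡m b))
  ... | inj₁ a | inj₂ b rewrite key-lt n e X a | key-ge n e X' b =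
        ⊥-elim (<⇒≱ (∸-monoˡ-< X'<n b) (≤-trans (m≤n+m (n ∸ e) X) (≤-reflexive eq)))
  ... | inj₂ a | inj₁ b rewrite key-ge n e X a | key-lt n e X' b =
        ⊥-elim (<⇒≱ (∸-monoˡ-< X<n a) (≤-trans (m≤n+m (n ∸ e) X') (≤-reflexive (sym eq))))

  key-surj : ∀ n e t → t < n → e ≤ n → Σ ℕ (λ X → X < n × keyℕ n e X ≡ t)
  key-surj n e t t<n e≤n with lt-or-ge t (n ∸ e)
  ... | inj₁ t<n∸e = t + e , subst (t + e <_) (m∸n+n≡m e≤n) (+-monoˡ-< e t<n∸e) ,
                     trans (key-ge n e (t + e) (m≤n+m e t)) (m+n∸n≡m t e)
  ... | inj₂ n∸e≤t = t ∸ (n ∸ e) , <-≤-trans X<e e≤n , trans (key-lt n e _ X<e) (m∸n+n≡m n∸e≤t)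
    where
    X<e : t ∸ (n ∸ e) < e
    X<e = ∸-<-split t (n ∸ e) e (subst (t <_) (trans (sym (m+[n∸m]≡n e≤n)) (+-comm e (n ∸ e))) t<n) n∸e≤t

  -- Numeric counterpart of punchIn: keys at or above κ move up by one.
  pIn : ℕ → ℕ → ℕ
  pIn κ v with v <? κ
  ... | yes _ = v
  ... | no  _ = suc v

  pIn-lt : ∀ κ v → v < κ → pIn κ v ≡ v
  pIn-lt κ v v<κ with v <? κ
  ... | yes _   = refl
  ... | no  v≮κ = ⊥-elim (v≮κ v<κ)

  pIn-ge : ∀ κ v → κ ≤ v → pIn κ v ≡ suc v
  pIn-ge κ v κ≤v with v <? κ
  ... | yes v<κ = ⊥-elim (<⇒≱ v<κ κ≤v)
  ... | no  _   = refl

  pIn-≥ : ∀ κ v → v ≤ pIn κ v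
  pIn-≥ κ v with v <? κ
  ... | yes _ = ≤-refl
  ... | no  _ = n≤1+n v

  suc∸ : ∀ m n → n ≤ m → suc m ∸ n ≡ suc (m ∸ n)
  suc∸ m zero _ = refl
  suc∸ (suc m) (suc n) (s≤s n≤m) = suc∸ m n n≤m

  -- The key that a vertex inserted at position X of cell c0 receives, relative
  -- to a root cell r ending at e in the row before the insertion.
  insKey : ∀ {k} → Fin k → Fin k → ℕ → ℕ → ℕ → ℕ
  insKey r c0 n e X with toℕ r <? toℕ c0
  ... | yes _ = X ∸ e
  ... | no  _ = X + (n ∸ e)

  module KeyIns {k n : ℕ} (sz : Vec ℕ k) (x : Fin (suc n)) (c0 : Fin k) (V : ValidIns sz x c0)
                (r : Fin k) (sum≡n : sum sz ≡ n) where
    open ValidIns V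

    e : ℕ
    e = End sz r

    κ : ℕ
    κ = insKey r c0 n e (toℕ x)

    e≤n : e ≤ n
    e≤n = subst (e ≤_) sum≡n (End-le-sum sz r)

    x≤n : toℕ x ≤ n
    x≤n = ≤-trans hi (subst (End sz c0 ≤_) sum≡n (End-le-sum sz c0))

    key-new : keyℕ (suc n) (End (incr c0 sz) r) (toℕ x) ≡ κ
    key-new with toℕ r <? toℕ c0
    ... | yes r<c0 rewrite End-incr-lt c0 r sz r<c0 =
          key-ge (suc n) e (toℕ x) (≤-trans (End-le-cum sz r c0 r<c0) lo)
    ... | no  r≮c0 rewrite End-incr-ge c0 r sz (≮⇒≥ r≮c0) =
          key-lt (suc n) (suc e) (toℕ x) (s≤s (≤-trans hi (End-mono sz c0 r (≮⇒≥ r≮c0))))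

    key-old-right : ∀ (y : Fin n) → toℕ r < toℕ c0 →
      keyℕ (suc n) e (toℕ (punchIn x y)) ≡ pIn (toℕ x ∸ e) (keyℕ n e (toℕ y))
    key-old-right y r<c0 with lt-or-ge (toℕ y) e | lt-or-ge (toℕ y) (toℕ x)
    ... | inj₂ e≤y | inj₁ y<x rewrite toℕ-punchIn-< x y y<x | key-ge (suc n) e (toℕ y) e≤y | key-ge n e (toℕ y) e≤y =
          sym (pIn-lt _ _ (∸-monoˡ-< y<x e≤y))
    ... | inj₂ e≤y | inj₂ x≤y rewrite toℕ-punchIn-≥ x y x≤y | key-ge (suc n) e (suc (toℕ y)) (m≤n⇒m≤1+n e≤y) | key-ge n e (toℕ y) e≤y =
          trans (suc∸ (toℕ y) e e≤y) (sym (pIn-ge _ _ (∸-monoˡ-≤ e x≤y)))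
    ... | inj₁ y<e | inj₂ x≤y = ⊥-elim (<⇒≱ y<e (≤-trans (≤-trans (End-le-cum sz r c0 r<c0) lo) x≤y))
    ... | inj₁ y<e | inj₁ y<x rewrite toℕ-punchIn-< x y y<x | key-lt (suc n) e (toℕ y) y<e | key-lt n e (toℕ y) y<e =
          trans (trans (cong (toℕ y +_) (suc∸ n e e≤n)) (+-suc _ _))
                (sym (pIn-ge _ _ (≤-trans (∸-monoˡ-≤ e x≤n) (m≤n+m _ _))))

    key-old-left : ∀ (y : Fin n) → toℕ c0 ≤ toℕ r →
      keyℕ (suc n) (suc e) (toℕ (punchIn x y)) ≡ pIn (toℕ x + (n ∸ e)) (keyℕ n e (toℕ y))
    key-old-left y c0≤r with lt-or-ge (toℕ y) e | lt-or-ge (toℕ y) (toℕ x)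
    ... | inj₂ e≤y | inj₁ y<x = ⊥-elim (<⇒≱ y<x (≤-trans (≤-trans hi (End-mono sz c0 r c0≤r)) e≤y))
    ... | inj₂ e≤y | inj₂ x≤y rewrite toℕ-punchIn-≥ x y x≤y | key-ge (suc n) (suc e) (suc (toℕ y)) (s≤s e≤y) | key-ge n e (toℕ y) e≤y =
          sym (pIn-lt _ _ (<-≤-trans (∸-monoˡ-< (toℕ<n y) e≤y) (m≤n+m _ _)))
    ... | inj₁ y<e | inj₁ y<x rewrite toℕ-punchIn-< x y y<x | key-lt (suc n) (suc e) (toℕ y) (m<n⇒m<1+n y<e) | key-lt n e (toℕ y) y<e =
          sym (pIn-lt _ _ (+-monoˡ-< (n ∸ e) y<x))
    ... | inj₁ y<e | inj₂ x≤y rewrite toℕ-punchIn-≥ x y x≤y | key-lt (suc n) (suc e) (suc (toℕ y)) (s≤s y<e) | key-lt n e (toℕ y) y<e =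
          sym (pIn-ge _ _ (+-monoˡ-≤ (n ∸ e) x≤y))

    key-old : ∀ (y : Fin n) → keyℕ (suc n) (End (incr c0 sz) r) (toℕ (punchIn x y)) ≡ pIn κ (keyℕ n e (toℕ y))
    key-old y with toℕ r <? toℕ c0
    ... | yes r<c0 rewrite End-incr-lt c0 r sz r<c0        = key-old-right y r<c0
    ... | no  r≮c0 rewrite End-incr-ge c0 r sz (≮⇒≥ r≮c0) = key-old-left y (≮⇒≥ r≮c0)

  -- Conversely, the place (position, cell) where a vertex must be inserted to
  -- receive key κ: keys below n ∸ e lie right of the root cell, the others
  -- inside or left of it, key n meaning "appended to the root cell".
  insPos : ℕ → ℕ → ℕ → ℕ
  insPos n e κ with κ <? n ∸ e
  ... | yes _ = κ + e
  ... | no  _ = κ ∸ (n ∸ e)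

  insCell : ∀ {k} → Vec ℕ (suc k) → Fin (suc k) → ℕ → ℕ → ℕ → Fin (suc k)
  insCell sz r n e κ with κ <? n
  ... | yes _ = colOf sz (insPos n e κ)
  ... | no  _ = r

  insPos-lt : ∀ n e κ → κ < n ∸ e → insPos n e κ ≡ κ + e
  insPos-lt n e κ κ< with κ <? n ∸ e
  ... | yes _  = refl
  ... | no  κ≮ = ⊥-elim (κ≮ κ<)

  insPos-ge : ∀ n e κ → ¬ (κ < n ∸ e) → insPos n e κ ≡ κ ∸ (n ∸ e)
  insPos-ge n e κ κ≮ with κ <? n ∸ e
  ... | yes κ< = ⊥-elim (κ≮ κ<)
  ... | no  _  = refl

  insCell-lt : ∀ {k} (sz : Vec ℕ (suc k)) r n e κ → κ < n → insCell sz r n e κ ≡ colOf sz (insPos n e κ)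
  insCell-lt sz r n e κ κ<n with κ <? n
  ... | yes _   = refl
  ... | no  κ≮n = ⊥-elim (κ≮n κ<n)

  insCell-ge : ∀ {k} (sz : Vec ℕ (suc k)) r n e κ → ¬ (κ < n) → insCell sz r n e κ ≡ r
  insCell-ge sz r n e κ κ≮n with κ <? n
  ... | yes κ<n = ⊥-elim (κ≮n κ<n)
  ... | no  _   = refl

  -- For a row of n vertices with root cell r: every key κ ≤ n has exactly one
  -- insertion place that is valid and does not append to a non-root cell.
  module InsChoice {k n : ℕ} (sz : Vec ℕ (suc k)) (r : Fin (suc k)) (sum≡n : sum sz ≡ n) where
    e : ℕ
    e = End sz r

    e≤n : e ≤ n
    e≤n = subst (e ≤_) sum≡n (End-le-sum sz r)

    record Good (κ X : ℕ) (c0 : Fin (suc k)) : Set where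
      field
        glo  : cum sz c0 ≤ X
        ghi  : X ≤ End sz c0
        gkey : insKey r c0 n e X ≡ κ
        gnr  : c0 ≢ r → X < End sz c0

    inner-good : ∀ κ X → (X<sum : X < sum sz) → insKey r (colOf sz X) n e X ≡ κ → Good κ X (colOf sz X)
    inner-good κ X X<sum k≡ = record { glo = proj₁ cell ; ghi = <⇒≤ (proj₂ cell) ; gkey = k≡ ; gnr = λ _ → proj₂ cell }
      where
      cell : cum sz (colOf sz X) ≤ X × X < End sz (colOf sz X)
      cell = colOf-cell sz X X<sum

    good-right : ∀ κ → κ < n ∸ e → Good κ (κ + e) (colOf sz (κ + e))
    good-right κ κ< = inner-good κ (κ + e) X<sum key≡
      where
      X<sum : κ + e < sum sz
      X<sum = subst (κ + e <_) (trans (m∸n+n≡m e≤n) (sym sum≡n)) (+-monoˡ-< e κ<)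
      key≡ : insKey r (colOf sz (κ + e)) n e (κ + e) ≡ κ
      key≡ with toℕ r <? toℕ (colOf sz (κ + e))
      ... | yes _   = m+n∸n≡m κ e
      ... | no  r≮c = ⊥-elim (<⇒≱ (proj₂ (colOf-cell sz (κ + e) X<sum))
                        (≤-trans (End-mono sz _ r (≮⇒≥ r≮c)) (m≤n+m e κ)))

    good-left : ∀ κ → n ∸ e ≤ κ → κ < n → Good κ (κ ∸ (n ∸ e)) (colOf sz (κ ∸ (n ∸ e)))
    good-left κ n∸e≤κ κ<n = inner-good κ X (<-≤-trans X<e (End-le-sum sz r)) key≡
      where
      X : ℕ
      X = κ ∸ (n ∸ e)
      X<e : X < e
      X<e = ∸-<-split κ (n ∸ e) e (subst (κ <_) (trans (sym (m+[n∸m]≡n e≤n)) (+-comm e (n ∸ e))) κ<n) n∸e≤κ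
      key≡ : insKey r (colOf sz X) n e X ≡ κ
      key≡ with toℕ r <? toℕ (colOf sz X)
      ... | yes r<c = ⊥-elim (<⇒≱ X<e (≤-trans (End-le-cum sz r _ r<c) (proj₁ (colOf-cell sz X (<-≤-trans X<e (End-le-sum sz r))))))
      ... | no  _   = m∸n+n≡m n∸e≤κ

    good-end : Good n e r
    good-end = record { glo = m≤m+n _ _ ; ghi = ≤-refl ; gkey = key≡ ; gnr = λ r≢r → ⊥-elim (r≢r refl) }
      where
      key≡ : insKey r r n e e ≡ n
      key≡ with toℕ r <? toℕ r
      ... | yes r<r = ⊥-elim (<-irrefl refl r<r)
      ... | no  _   = m+[n∸m]≡n e≤n

    exists : ∀ κ → κ ≤ n → Good κ (insPos n e κ) (insCell sz r n e κ)
    exists κ κ≤n with lt-or-ge κ (n ∸ e)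
    ... | inj₁ κ< = subst₂ (Good κ) (sym (insPos-lt n e κ κ<))
          (sym (trans (insCell-lt sz r n e κ (<-≤-trans κ< (m∸n≤m n e))) (cong (colOf sz) (insPos-lt n e κ κ<))))
          (good-right κ κ<)
    ... | inj₂ n∸e≤κ with lt-or-ge κ n
    ...   | inj₁ κ<n = subst₂ (Good κ) (sym (insPos-ge n e κ (≤⇒≯ n∸e≤κ)))
            (sym (trans (insCell-lt sz r n e κ κ<n) (cong (colOf sz) (insPos-ge n e κ (≤⇒≯ n∸e≤κ)))))
            (good-left κ n∸e≤κ κ<n)
    ...   | inj₂ n≤κ with ≤-antisym κ≤n n≤κ
    ...     | refl = subst₂ (Good n) (sym (trans (insPos-ge n e n (≤⇒≯ n∸e≤κ)) (m∸[m∸n]≡n e≤n)))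
                       (sym (insCell-ge sz r n e n (<-irrefl refl)))
                       good-end

    unique-right : ∀ X c0 → Good (X ∸ e) X c0 → toℕ r < toℕ c0 →
      X ≡ insPos n e (X ∸ e) × c0 ≡ insCell sz r n e (X ∸ e)
    unique-right X c0 g r<c0 = X≡ , c0≡
      where
      open Good g
      c0≢r : c0 ≢ r
      c0≢r c0≡r = <-irrefl (cong toℕ (sym c0≡r)) r<c0
      e≤X : e ≤ X
      e≤X = ≤-trans (End-le-cum sz r c0 r<c0) glo
      X<sum : X < sum sz
      X<sum = <-≤-trans (gnr c0≢r) (End-le-sum sz c0)
      κ< : X ∸ e < n ∸ e
      κ< = ∸-monoˡ-< (subst (X <_) sum≡n X<sum) e≤X
      X≡ : X ≡ insPos n e (X ∸ e)
      X≡ = sym (trans (insPos-lt n e (X ∸ e) κ<) (m∸n+n≡m e≤X))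
      c0≡ : c0 ≡ insCell sz r n e (X ∸ e)
      c0≡ = trans (sym (colOf-unique sz X c0 glo (gnr c0≢r) X<sum))
                  (trans (cong (colOf sz) X≡) (sym (insCell-lt sz r n e (X ∸ e) (≤-trans κ< (m∸n≤m n e)))))

    unique-left : ∀ X c0 → Good (X + (n ∸ e)) X c0 → toℕ c0 ≤ toℕ r →
      X ≡ insPos n e (X + (n ∸ e)) × c0 ≡ insCell sz r n e (X + (n ∸ e))
    unique-left X c0 g c0≤r = X≡ , c0≡
      where
      open Good g
      X≡ : X ≡ insPos n e (X + (n ∸ e))
      X≡ = sym (trans (insPos-ge n e _ (λ l → <⇒≱ l (m≤n+m _ _))) (m+n∸n≡m X (n ∸ e)))
      c0≡ : c0 ≡ insCell sz r n e (X + (n ∸ e))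
      c0≡ with X ≟ e | c0 ≟F r
      ... | yes X≡e | yes c0≡r = sym (trans (insCell-ge sz r n e _
                                   (λ l → <-irrefl (trans (cong (_+ (n ∸ e)) X≡e) (m+[n∸m]≡n e≤n)) l)) (sym c0≡r))
      ... | yes X≡e | no  c0≢r = ⊥-elim (<⇒≱ (gnr c0≢r) (≤-trans (End-mono sz c0 r c0≤r) (≤-reflexive (sym X≡e))))
      ... | no  X≢e | _    = trans (sym (colOf-unique sz X c0 glo X<end X<sum))
                               (trans (cong (colOf sz) X≡) (sym (insCell-lt sz r n e _ κ<n)))
        where
        X<end : X < End sz c0
        X<end with c0 ≟F r
        ... | no  c0≢r = gnr c0≢r
        ... | yes refl = ≤∧≢⇒< ghi X≢e
        X<e : X < e
        X<e = <-≤-trans X<end (End-mono sz c0 r c0≤r)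
        X<sum : X < sum sz
        X<sum = <-≤-trans X<e (End-le-sum sz r)
        κ<n : X + (n ∸ e) < n
        κ<n = subst (X + (n ∸ e) <_) (m+[n∸m]≡n e≤n) (+-monoˡ-< (n ∸ e) X<e)

    unique : ∀ κ X c0 → Good κ X c0 → X ≡ insPos n e κ × c0 ≡ insCell sz r n e κ
    unique κ X c0 g with toℕ r <? toℕ c0 | Good.gkey g
    ... | yes r<c0 | refl = unique-right X c0 g r<c0
    ... | no  r≮c0 | refl = unique-left X c0 g (≮⇒≥ r≮c0)

module PairExtension where
  open CellLayout

  private
    T→≡ : ∀ b → T b → b ≡ true
    T→≡ true _ = refl

    ≡→T : ∀ {b} → b ≡ true → T b
    ≡→T refl = tt

    ∧-true : ∀ a b → a ∧ b ≡ true → a ≡ true × b ≡ true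
    ∧-true true true _ = refl , refl

  bool-ext : ∀ a b → (a ≡ true → b ≡ true) → (b ≡ true → a ≡ true) → a ≡ b
  bool-ext true  b     a⇒b b⇒a = sym (a⇒b refl)
  bool-ext false true  a⇒b b⇒a = b⇒a refl
  bool-ext false false a⇒b b⇒a = refl

  inCellᵇ→ : ∀ {n k} (sz : Vec ℕ k) (i : Fin n) c → inCellᵇ sz i c ≡ true → InCell sz i c
  inCellᵇ→ sz i c e with ∧-true _ _ e
  ... | e1 , e2 = ≤ᵇ⇒≤ _ _ (≡→T e1) , <ᵇ⇒< _ _ (≡→T e2)

  →inCellᵇ : ∀ {n k} (sz : Vec ℕ k) (i : Fin n) c → InCell sz i c → inCellᵇ sz i c ≡ true
  →inCellᵇ sz i c (l , h) rewrite T→≡ _ (≤⇒≤ᵇ l) | T→≡ _ (<⇒<ᵇ h) = refl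

  count-punchIn : ∀ {n} (f : Fin (suc n) → Bool) x → f x ≡ false →
    ∣ tabulate f ∣ ≡ ∣ tabulate (λ i → f (punchIn x i)) ∣
  count-punchIn f zero fx≡ rewrite fx≡ = refl
  count-punchIn {suc n} f (suc x) fx≡ with f zero | count-punchIn (λ i → f (suc i)) x fx≡
  ... | true  | ih = cong suc ih
  ... | false | ih = ih

  count-cong : ∀ {n} (f g : Fin n → Bool) → (∀ i → f i ≡ g i) → ∣ tabulate f ∣ ≡ ∣ tabulate g ∣
  count-cong f g f≗g = cong ∣_∣ (tabulate-cong f≗g)

  pos-sum : ∀ a b → 1 ≤ a + b → 1 ≤ a ⊎ 1 ≤ b
  pos-sum (suc a) b _ = inj₁ (s≤s z≤n)
  pos-sum zero (suc b) _ = inj₂ (s≤s z≤n)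

  mapReaches : ∀ {k} {R R' : Subset k} {Arc Arc' : Fin k → Fin k → Set} →
    (∀ c → c ∈ R → c ∈ R') → (∀ c d → Arc c d → Arc' c d) → ∀ c → Reaches R Arc c → Reaches R' Arc' c
  mapReaches fR fA c (root c∈R)              = root (fR c c∈R)
  mapReaches fR fA c (step {d = d} arc reach) = step (fA c d arc) (mapReaches fR fA d reach)

  -- Adding two row-1 vertices at positions xv and `punchIn xv xw`: the old
  -- row-1 vertex y is renumbered σf xv xw y, row-2 vertices are unchanged.
  σf : ∀ {n} → Fin (suc (suc n)) → Fin (suc n) → Fin n → Fin (suc (suc n))
  σf xv xw y = punchIn xv (punchIn xw y)

  σV : ∀ {n q} → Fin (suc (suc n)) → Fin (suc n) → Vertex n q → Vertex (suc (suc n)) q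
  σV xv xw (inj₁ y) = inj₁ (σf xv xw y)
  σV xv xw (inj₂ j) = inj₂ j

  classify2 : ∀ {n} (xv : Fin (suc (suc n))) (xw : Fin (suc n)) z →
    z ≡ xv ⊎ (z ≡ punchIn xv xw ⊎ Σ (Fin n) (λ y → z ≡ σf xv xw y))
  classify2 xv xw z with xv ≟F z
  ... | yes xv≡z = inj₁ (sym xv≡z)
  ... | no  xv≢z with xw ≟F punchOut xv≢z
  ...   | yes e = inj₂ (inj₁ (trans (sym (punchIn-punchOut xv≢z)) (cong (punchIn xv) (sym e))))
  ...   | no  ne = inj₂ (inj₂ (punchOut ne ,
                   trans (sym (punchIn-punchOut xv≢z)) (cong (punchIn xv) (sym (punchIn-punchOut ne)))))

  record Ext {n q K : ℕ} (B : Raw n q K) (A : Raw (suc (suc n)) q K) : Set where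
    field
      xv   : Fin (suc (suc n))
      xw   : Fin (suc n)
      pσ   : ∀ u → partner A (σV xv xw u) ≡ σV xv xw (partner B u)
      pa   : partner A (inj₁ xv) ≡ inj₁ (punchIn xv xw)
      pb   : partner A (inj₁ (punchIn xv xw)) ≡ inj₁ xv
      sz2≡ : Raw.sz2 A ≡ Raw.sz2 B
      R≡   : Raw.R A ≡ Raw.R B
      R'≡  : Raw.R' A ≡ Raw.R' B
      cell→ : ∀ y c → InCell (Raw.sz1 B) y c → InCell (Raw.sz1 A) (σf xv xw y) c
      cell← : ∀ y c → InCell (Raw.sz1 A) (σf xv xw y) c → InCell (Raw.sz1 B) y c
      rm→  : ∀ y c → c ∉ Raw.R B → Rightmost (Raw.sz1 B) y c → Rightmost (Raw.sz1 A) (σf xv xw y) c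
      rm←  : ∀ y c → Rightmost (Raw.sz1 A) (σf xv xw y) c → Rightmost (Raw.sz1 B) y c
      rmA  : ∀ x c → c ∉ Raw.R B → Rightmost (Raw.sz1 A) x c → Σ (Fin n) (λ y → x ≡ σf xv xw y)

  module ExtFacts {n q K : ℕ} {B : Raw n q K} {A : Raw (suc (suc n)) q K} (E : Ext B A) where
    open Ext E

    b : Fin (suc (suc n))
    b = punchIn xv xw

    σ : Fin n → Fin (suc (suc n))
    σ = σf xv xw

    σ̂ : Vertex n q → Vertex (suc (suc n)) q
    σ̂ = σV xv xw

    b≢a : b ≢ xv
    b≢a = punchInᵢ≢i xv xw

    σ≢a : ∀ y → σ y ≢ xv
    σ≢a y = punchInᵢ≢i xv _

    σ≢b : ∀ y → σ y ≢ b
    σ≢b y e = punchInᵢ≢i xw y (punchIn-injective xv _ _ e)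

    σ̂-inj : ∀ u u' → σ̂ u ≡ σ̂ u' → u ≡ u'
    σ̂-inj (inj₁ y) (inj₁ y') e = cong inj₁ (punchIn-injective xw _ _ (punchIn-injective xv _ _ (inj₁-injective e)))
    σ̂-inj (inj₂ j) (inj₂ .j) refl = refl

    isRow1σ : ∀ u → isRow1 (σ̂ u) ≡ isRow1 u
    isRow1σ (inj₁ _) = refl
    isRow1σ (inj₂ _) = refl

    isRow2σ : ∀ u → isRow2 (σ̂ u) ≡ isRow2 u
    isRow2σ (inj₁ _) = refl
    isRow2σ (inj₂ _) = refl

    count-σ : (f : Fin (suc (suc n)) → Bool) → f xv ≡ false → f b ≡ false →
      ∣ tabulate f ∣ ≡ ∣ tabulate (λ y → f (σ y)) ∣
    count-σ f fa fb = trans (count-punchIn f xv fa) (count-punchIn (λ i → f (punchIn xv i)) xw fb)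

    m1σ : ∀ y → lookup (Raw.m1 A) (σ y) ≡ σ̂ (lookup (Raw.m1 B) y)
    m1σ y = pσ (inj₁ y)

    m2σ : ∀ j → lookup (Raw.m2 A) j ≡ σ̂ (lookup (Raw.m2 B) j)
    m2σ j = pσ (inj₂ j)

    inCellᵇσ : ∀ y c → inCellᵇ (Raw.sz1 A) (σ y) c ≡ inCellᵇ (Raw.sz1 B) y c
    inCellᵇσ y c = bool-ext _ _ (λ e → →inCellᵇ (Raw.sz1 B) y c (cell← y c (inCellᵇ→ (Raw.sz1 A) (σ y) c e)))
                                 (λ e → →inCellᵇ (Raw.sz1 A) (σ y) c (cell→ y c (inCellᵇ→ (Raw.sz1 B) y c e)))

    mixed1σ : ∀ y → isRow2 (lookup (Raw.m1 A) (σ y)) ≡ isRow2 (lookup (Raw.m1 B) y)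
    mixed1σ y = trans (cong isRow2 (m1σ y)) (isRow2σ (lookup (Raw.m1 B) y))

    -- the new pair is not mixed, so the mixed-pair statistics are unchanged
    mixedCount≡ : mixedCount A ≡ mixedCount B
    mixedCount≡ = trans (count-σ (λ i → isRow2 (lookup (Raw.m1 A) i)) (cong isRow2 pa) (cong isRow2 pb))
                        (count-cong _ _ mixed1σ)

    mixedIn1≡ : ∀ c → mixedIn1 A c ≡ mixedIn1 B c
    mixedIn1≡ c = trans (count-σ (λ i → inCellᵇ (Raw.sz1 A) i c ∧ isRow2 (lookup (Raw.m1 A) i))
                          (trans (cong (λ v → inCellᵇ (Raw.sz1 A) xv c ∧ isRow2 v) pa) (∧-zeroʳ _))
                          (trans (cong (λ v → inCellᵇ (Raw.sz1 A) b c ∧ isRow2 v) pb) (∧-zeroʳ _)))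
                        (count-cong _ _ (λ y → cong₂ _∧_ (inCellᵇσ y c) (mixed1σ y)))

    mixedIn2≡ : ∀ c → mixedIn2 A c ≡ mixedIn2 B c
    mixedIn2≡ c = count-cong _ _ (λ j → cong₂ _∧_ (cong (λ s → inCellᵇ s j c) sz2≡)
                    (trans (cong isRow1 (m2σ j)) (isRow1σ (lookup (Raw.m2 B) j))))

    colσ→ : ∀ u d → ColOf B u d → ColOf A (σ̂ u) d
    colσ→ (inj₁ y) d h = cell→ y d h
    colσ→ (inj₂ j) d h = subst (λ s → InCell s j d) (sym sz2≡) h

    colσ← : ∀ u d → ColOf A (σ̂ u) d → ColOf B u d
    colσ← (inj₁ y) d h = cell← y d h
    colσ← (inj₂ j) d h = subst (λ s → InCell s j d) sz2≡ h

    ∉R→ : ∀ c → c ∉ Raw.R B → c ∉ Raw.R A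
    ∉R→ c = subst (c ∉_) (sym R≡)
    ∉R← : ∀ c → c ∉ Raw.R A → c ∉ Raw.R B
    ∉R← c = subst (c ∉_) R≡
    ∉R'→ : ∀ c → c ∉ Raw.R' B → c ∉ Raw.R' A
    ∉R'→ c = subst (c ∉_) (sym R'≡)
    ∉R'← : ∀ c → c ∉ Raw.R' A → c ∉ Raw.R' B
    ∉R'← c = subst (c ∉_) R'≡

    rm2→ : ∀ (j : Fin q) c → Rightmost (Raw.sz2 B) j c → Rightmost (Raw.sz2 A) j c
    rm2→ j c = subst (λ s → Rightmost s j c) (sym sz2≡)
    rm2← : ∀ (j : Fin q) c → Rightmost (Raw.sz2 A) j c → Rightmost (Raw.sz2 B) j c
    rm2← j c = subst (λ s → Rightmost s j c) sz2≡

    arc1→ : ∀ c d → Arc1 B c d → Arc1 A c d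
    arc1→ c d (cn , i , rm , col) = ∉R→ c cn , σ i , rm→ i c cn rm ,
      subst (λ v → ColOf A v d) (sym (m1σ i)) (colσ→ _ d col)

    arc1← : ∀ c d → Arc1 A c d → Arc1 B c d
    arc1← c d (cn , i , rm , col) with rmA i c (∉R← c cn) rm
    ... | y , refl = ∉R← c cn , y , rm← y c rm , colσ← _ d (subst (λ v → ColOf A v d) (m1σ y) col)

    arc2→ : ∀ c d → Arc2 B c d → Arc2 A c d
    arc2→ c d (cn , j , rm , col) = ∉R'→ c cn , j , rm2→ j c rm ,
      subst (λ v → ColOf A v d) (sym (m2σ j)) (colσ→ _ d col)

    arc2← : ∀ c d → Arc2 A c d → Arc2 B c d
    arc2← c d (cn , j , rm , col) = ∉R'← c cn , j , rm2← j c rm , colσ← _ d (subst (λ v → ColOf A v d) (m2σ j) col)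

    ne1→ : sum (Raw.sz1 B) ≡ n → ∀ c → c ∉ Raw.R B → 1 ≤ lookup (Raw.sz1 B) c → 1 ≤ lookup (Raw.sz1 A) c
    ne1→ s c cn h with nonempty⇒rightmost (Raw.sz1 B) s c h
    ... | y , rm = InCell⇒nonempty (Raw.sz1 A) _ c (proj₁ (rm→ y c cn rm))

    ne1← : sum (Raw.sz1 A) ≡ suc (suc n) → ∀ c → c ∉ Raw.R B → 1 ≤ lookup (Raw.sz1 A) c → 1 ≤ lookup (Raw.sz1 B) c
    ne1← s c cn h with nonempty⇒rightmost (Raw.sz1 A) s c h
    ... | x , rm with rmA x c cn rm
    ...   | y , refl = InCell⇒nonempty (Raw.sz1 B) y c (proj₁ (rm← y c rm))

    partner-inv→ : (∀ v → partner B (partner B v) ≡ v) → ∀ v → partner A (partner A v) ≡ v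
    partner-inv→ inv (inj₂ j) = trans (cong (partner A) (pσ (inj₂ j))) (trans (pσ (partner B (inj₂ j))) (cong σ̂ (inv (inj₂ j))))
    partner-inv→ inv (inj₁ z) with classify2 xv xw z
    ... | inj₁ refl = trans (cong (partner A) pa) pb
    ... | inj₂ (inj₁ refl) = trans (cong (partner A) pb) pa
    ... | inj₂ (inj₂ (y , refl)) = trans (cong (partner A) (pσ (inj₁ y))) (trans (pσ (partner B (inj₁ y))) (cong σ̂ (inv (inj₁ y))))

    partner-inv← : (∀ v → partner A (partner A v) ≡ v) → ∀ v → partner B (partner B v) ≡ v
    partner-inv← inv v = σ̂-inj _ _ (trans (sym (pσ (partner B v))) (trans (cong (partner A) (sym (pσ v))) (inv (σ̂ v))))

    nofix→ : (∀ v → partner B v ≢ v) → ∀ v → partner A v ≢ v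
    nofix→ nf (inj₂ j) e = nf (inj₂ j) (σ̂-inj _ _ (trans (sym (pσ (inj₂ j))) e))
    nofix→ nf (inj₁ z) e with classify2 xv xw z
    ... | inj₁ refl = b≢a (inj₁-injective (trans (sym pa) e))
    ... | inj₂ (inj₁ refl) = b≢a (sym (inj₁-injective (trans (sym pb) e)))
    ... | inj₂ (inj₂ (y , refl)) = nf (inj₁ y) (σ̂-inj _ _ (trans (sym (pσ (inj₁ y))) e))

    nofix← : (∀ v → partner A v ≢ v) → ∀ v → partner B v ≢ v
    nofix← nf v e = nf (σ̂ v) (trans (pσ v) (cong σ̂ e))

    forward : ∀ {s} → IsPairedArray n q s K B → sum (Raw.sz1 A) ≡ suc (suc n) → IsPairedArray (suc (suc n)) q s K A
    forward {s} P sum≡ = record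
      { rowSum1 = sum≡
      ; rowSum2 = trans (cong sum sz2≡) rowSum2
      ; involutive = partner-inv→ involutive
      ; noFixed = nofix→ noFixed
      ; mixed = trans mixedCount≡ mixed
      ; balance = λ c → trans (mixedIn1≡ c) (trans (balance c) (sym (mixedIn2≡ c)))
      ; markedR = subst Nonempty (sym R≡) markedR
      ; markedR' = subst Nonempty (sym R'≡) markedR'
      ; nonempty = ne
      ; forest1 = f1
      ; forest2 = λ c h → mapReaches (λ c' → subst (c' ∈_) (sym R'≡)) arc2→ c
                            (forest2 c (subst (λ s → 1 ≤ lookup s c) sz2≡ h))
      }
      where
      open IsPairedArray P
      ne : ∀ c → c ∉ Raw.R A → c ∉ Raw.R' A → 1 ≤ lookup (Raw.sz1 A) c + lookup (Raw.sz2 A) c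
      ne c cn cn' with pos-sum _ _ (nonempty c (∉R← c cn) (∉R'← c cn'))
      ... | inj₁ h = ≤-trans (ne1→ rowSum1 c (∉R← c cn) h) (m≤m+n _ _)
      ... | inj₂ h = ≤-trans (subst (λ s → 1 ≤ lookup s c) (sym sz2≡) h) (m≤n+m _ _)
      f1 : ∀ c → 1 ≤ lookup (Raw.sz1 A) c → Reaches (Raw.R A) (Arc1 A) c
      f1 c h with c ∈? Raw.R A
      ... | yes c∈R = root c∈R
      ... | no  c∉R = mapReaches (λ c' → subst (c' ∈_) (sym R≡)) arc1→ c
                        (forest1 c (ne1← sum≡ c (∉R← c c∉R) h))

    backward : ∀ {s} → IsPairedArray (suc (suc n)) q s K A → sum (Raw.sz1 B) ≡ n → IsPairedArray n q s K B
    backward {s} P sum≡ = record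
      { rowSum1 = sum≡
      ; rowSum2 = trans (cong sum (sym sz2≡)) rowSum2
      ; involutive = partner-inv← involutive
      ; noFixed = nofix← noFixed
      ; mixed = trans (sym mixedCount≡) mixed
      ; balance = λ c → trans (sym (mixedIn1≡ c)) (trans (balance c) (mixedIn2≡ c))
      ; markedR = subst Nonempty R≡ markedR
      ; markedR' = subst Nonempty R'≡ markedR'
      ; nonempty = ne
      ; forest1 = f1
      ; forest2 = λ c h → mapReaches (λ c' → subst (c' ∈_) R'≡) arc2← c
                            (forest2 c (subst (λ s → 1 ≤ lookup s c) (sym sz2≡) h))
      }
      where
      open IsPairedArray P
      ne : ∀ c → c ∉ Raw.R B → c ∉ Raw.R' B → 1 ≤ lookup (Raw.sz1 B) c + lookup (Raw.sz2 B) c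
      ne c cn cn' with pos-sum _ _ (nonempty c (∉R→ c cn) (∉R'→ c cn'))
      ... | inj₁ h = ≤-trans (ne1← rowSum1 c cn h) (m≤m+n _ _)
      ... | inj₂ h = ≤-trans (subst (λ s → 1 ≤ lookup s c) sz2≡ h) (m≤n+m _ _)
      f1 : ∀ c → 1 ≤ lookup (Raw.sz1 B) c → Reaches (Raw.R B) (Arc1 B) c
      f1 c h with c ∈? Raw.R B
      ... | yes c∈R = root c∈R
      ... | no  c∉R = mapReaches (λ c' → subst (c' ∈_) R≡) arc1← c (forest1 c (ne1→ sum≡ c c∉R h))

    ru→ : ∀ u → RightmostUnmarked B u → RightmostUnmarked A (σ̂ u)
    ru→ (inj₁ y) (c , rm , cn) = c , rm→ y c cn rm , ∉R→ c cn
    ru→ (inj₂ j) (c , rm , cn) = c , rm2→ j c rm , ∉R'→ c cn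

    ru← : ∀ u → RightmostUnmarked A (σ̂ u) → RightmostUnmarked B u
    ru← (inj₁ y) (c , rm , cn) = c , rm← y c rm , ∉R← c cn
    ru← (inj₂ j) (c , rm , cn) = c , rm2← j c rm , ∉R'← c cn

    ru-a : RightmostUnmarked A (inj₁ xv) → ⊥
    ru-a (c , rm , cn) with rmA xv c (∉R← c cn) rm
    ... | y , e = σ≢a y (sym e)

    ru-b : RightmostUnmarked A (inj₁ b) → ⊥
    ru-b (c , rm , cn) with rmA b c (∉R← c cn) rm
    ... | y , e = σ≢b y (sym e)

    red← : ∀ u → Redundant A (σ̂ u) → Redundant B u
    red← u (same , n1 , n2) =
      trans (sym (isRow1σ u)) (trans same (trans (cong isRow1 (pσ u)) (isRow1σ (partner B u)))) ,
      (λ h → n1 (ru→ u h)) ,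
      (λ h → n2 (subst (RightmostUnmarked A) (sym (pσ u)) (ru→ _ h)))

    red→ : ∀ u → Redundant B u → Redundant A (σ̂ u)
    red→ u (same , n1 , n2) =
      trans (isRow1σ u) (trans same (trans (sym (isRow1σ (partner B u))) (cong isRow1 (sym (pσ u))))) ,
      (λ h → n1 (ru← u h)) ,
      (λ h → n2 (ru← _ (subst (RightmostUnmarked A) (pσ u) h)))

    red-a : Redundant A (inj₁ xv)
    red-a = cong isRow1 (sym pa) , ru-a , (λ h → ru-b (subst (RightmostUnmarked A) pa h))

    red-b : Redundant A (inj₁ b)
    red-b = cong isRow1 (sym pb) , ru-b , (λ h → ru-a (subst (RightmostUnmarked A) pb h))

module PairInsertion where
  open CellLayout
  open PairExtension

  ext : ∀ {n} {X : Set} → Fin (suc n) → (Fin n → X) → X → Fin (suc n) → X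
  ext x f d z with x ≟F z
  ... | yes _   = d
  ... | no  x≢z = f (punchOut x≢z)

  ext-x : ∀ {n} {X : Set} (x : Fin (suc n)) (f : Fin n → X) d → ext x f d x ≡ d
  ext-x x f d with x ≟F x
  ... | yes _   = refl
  ... | no  x≢x = ⊥-elim (x≢x refl)

  ext-σ : ∀ {n} {X : Set} (x : Fin (suc n)) (f : Fin n → X) d y → ext x f d (punchIn x y) ≡ f y
  ext-σ x f d y with x ≟F punchIn x y
  ... | yes e = ⊥-elim (punchInᵢ≢i x y (sym e))
  ... | no  _ = cong f (trans (punchOut-cong x refl) (punchOut-punchIn x))

  module _ {n q K : ℕ} where
    newPartner1 : Raw n q K → Fin (suc n) → Fin (suc (suc n)) → Fin (suc (suc n)) → Vertex (suc (suc n)) q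
    newPartner1 B xw xv =
      ext xv (ext xw (λ y → σV xv xw (lookup (Raw.m1 B) y)) (inj₁ xv)) (inj₁ (punchIn xv xw))

    insertPair : Raw n q K → Fin (suc n) → Fin K → Fin (suc (suc n)) → Fin K → Raw (suc (suc n)) q K
    insertPair B xw cw xv cv = mkRaw
      (incr cv (incr cw (Raw.sz1 B)))
      (Raw.sz2 B)
      (tabulate (newPartner1 B xw xv))
      (tabulate (λ j → σV xv xw (lookup (Raw.m2 B) j)))
      (Raw.R B) (Raw.R' B)

    module InsertPairFacts (B : Raw n q K) (xw : Fin (suc n)) (cw : Fin K) (xv : Fin (suc (suc n))) (cv : Fin K) where
      A : Raw (suc (suc n)) q K
      A = insertPair B xw cw xv cv

      row1 : Fin (suc (suc n)) → Vertex (suc (suc n)) q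
      row1 = newPartner1 B xw xv

      row1-a : row1 xv ≡ inj₁ (punchIn xv xw)
      row1-a = ext-x xv _ _

      row1-b : row1 (punchIn xv xw) ≡ inj₁ xv
      row1-b = trans (ext-σ xv _ _ xw) (ext-x xw _ (inj₁ xv))

      row1-σ : ∀ y → row1 (σf xv xw y) ≡ σV xv xw (lookup (Raw.m1 B) y)
      row1-σ y = trans (ext-σ xv _ _ (punchIn xw y)) (ext-σ xw _ (inj₁ xv) y)

      pσ : ∀ u → partner A (σV xv xw u) ≡ σV xv xw (partner B u)
      pσ (inj₁ y) = trans (lookup∘tabulate row1 (σf xv xw y)) (row1-σ y)
      pσ (inj₂ j) = lookup∘tabulate (λ j → σV xv xw (lookup (Raw.m2 B) j)) j

      pa : partner A (inj₁ xv) ≡ inj₁ (punchIn xv xw)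
      pa = trans (lookup∘tabulate row1 xv) row1-a

      pb : partner A (inj₁ (punchIn xv xw)) ≡ inj₁ xv
      pb = trans (lookup∘tabulate row1 (punchIn xv xw)) row1-b

      module _ (V1 : ValidIns (Raw.sz1 B) xw cw) (V2 : ValidIns (incr cw (Raw.sz1 B)) xv cv)
               (nr1 : cw ∉ Raw.R B → toℕ xw ≡ End (Raw.sz1 B) cw → ⊥)
               (nr2 : cv ∉ Raw.R B → toℕ xv ≡ End (incr cw (Raw.sz1 B)) cv → ⊥) where
        private
          module I1 = Insertion (Raw.sz1 B) xw cw V1
          module I2 = Insertion (incr cw (Raw.sz1 B)) xv cv V2

        rmA : ∀ x c → c ∉ Raw.R B → Rightmost (Raw.sz1 A) x c → Σ (Fin n) (λ y → x ≡ σf xv xw y)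
        rmA x c cn rm with classify2 xv xw x
        ... | inj₁ refl with I2.rm-new c rm
        ...   | refl , e = ⊥-elim (nr2 cn e)
        rmA x c cn rm | inj₂ (inj₁ refl) with I1.rm-new c (I2.rm-bwd xw c rm)
        ...   | refl , e = ⊥-elim (nr1 cn e)
        rmA x c cn rm | inj₂ (inj₂ (y , e)) = y , e

        ext-ok : Ext B A
        ext-ok = record
          { xv = xv ; xw = xw ; pσ = pσ ; pa = pa ; pb = pb
          ; sz2≡ = refl ; R≡ = refl ; R'≡ = refl
          ; cell→ = λ y c h → I2.cell-fwd (punchIn xw y) c (I1.cell-fwd y c h)
          ; cell← = λ y c h → I1.cell-bwd y c (I2.cell-bwd (punchIn xw y) c h)
          ; rm→ = λ y c cn rm → I2.rm-fwd (punchIn xw y) c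
                     (I1.rm-fwd y c rm (λ { refl e → nr1 cn e }))
                     (λ { refl e → nr2 cn e })
          ; rm← = λ y c rm → I1.rm-bwd y c (I2.rm-bwd (punchIn xw y) c rm)
          ; rmA = rmA
          }

    insertPair-char : (B : Raw n q K) (A : Raw (suc (suc n)) q K) (xw : Fin (suc n)) (cw : Fin K)
      (xv : Fin (suc (suc n))) (cv : Fin K) →
      Raw.sz1 A ≡ incr cv (incr cw (Raw.sz1 B)) → Raw.sz2 A ≡ Raw.sz2 B →
      Raw.R A ≡ Raw.R B → Raw.R' A ≡ Raw.R' B →
      (∀ u → partner A (σV xv xw u) ≡ σV xv xw (partner B u)) →
      partner A (inj₁ xv) ≡ inj₁ (punchIn xv xw) → partner A (inj₁ (punchIn xv xw)) ≡ inj₁ xv →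
      A ≡ insertPair B xw cw xv cv
    insertPair-char B (mkRaw s1 s2 m1 m2 R R') xw cw xv cv refl refl refl refl pσ pa pb =
      cong₂ (λ x y → mkRaw (incr cv (incr cw (Raw.sz1 B))) (Raw.sz2 B) x y (Raw.R B) (Raw.R' B))
        (trans (sym (tabulate∘lookup m1)) (tabulate-cong m1≗))
        (trans (sym (tabulate∘lookup m2)) (tabulate-cong (λ j → pσ (inj₂ j))))
      where
      open InsertPairFacts B xw cw xv cv using (row1; row1-a; row1-b; row1-σ)
      m1≗ : ∀ z → lookup m1 z ≡ row1 z
      m1≗ z with classify2 xv xw z
      ... | inj₁ refl               = trans pa (sym row1-a)
      ... | inj₂ (inj₁ refl)        = trans pb (sym row1-b)
      ... | inj₂ (inj₂ (y , refl)) = trans (pσ (inj₁ y)) (sym (row1-σ y))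

    insertPair-inj : (B B' : Raw n q K) (xw : Fin (suc n)) (cw : Fin K) (xv : Fin (suc (suc n))) (cv : Fin K) →
      insertPair B xw cw xv cv ≡ insertPair B' xw cw xv cv → B ≡ B'
    insertPair-inj B@(mkRaw s1 s2 m1 m2 R R') B'@(mkRaw s1' s2' m1' m2' R₂ R₂') xw cw xv cv e
      with incr-injective cw _ _ (incr-injective cv _ _ (cong Raw.sz1 e)) | cong Raw.sz2 e | cong Raw.R e | cong Raw.R' e
    ... | refl | refl | refl | refl =
      cong₂ (λ x y → mkRaw s1 s2 x y R R')
        (trans (sym (tabulate∘lookup m1)) (trans (tabulate-cong m1≗) (tabulate∘lookup m1')))
        (trans (sym (tabulate∘lookup m2)) (trans (tabulate-cong m2≗) (tabulate∘lookup m2')))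
      where
      module G  = InsertPairFacts B  xw cw xv cv
      module G' = InsertPairFacts B' xw cw xv cv
      σ̂-inj : ∀ u u' → σV {n} {q} xv xw u ≡ σV xv xw u' → u ≡ u'
      σ̂-inj (inj₁ y) (inj₁ y') e' = cong inj₁ (punchIn-injective xw _ _ (punchIn-injective xv _ _ (inj₁-injective e')))
      σ̂-inj (inj₂ j) (inj₂ .j) refl = refl
      m1≗ : ∀ y → lookup m1 y ≡ lookup m1' y
      m1≗ y = σ̂-inj _ _ (trans (sym (G.pσ (inj₁ y))) (trans (cong (λ A → partner A (inj₁ (σf xv xw y))) e) (G'.pσ (inj₁ y))))
      m2≗ : ∀ j → lookup m2 j ≡ lookup m2' j
      m2≗ j = σ̂-inj _ _ (trans (sym (G.pσ (inj₂ j))) (trans (cong (λ A → partner A (inj₂ j)) e) (G'.pσ (inj₂ j))))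

module Stages where
  open CellLayout
  open CyclicKeys

  rootOf : ∀ {k} → Subset (suc k) → Fin (suc k)
  rootOf (true ∷ _)      = zero
  rootOf (false ∷ [])    = zero
  rootOf (false ∷ x ∷ R) = suc (rootOf (x ∷ R))

  private
    empty-∉ : ∀ {k} (R : Subset k) → ∣ R ∣ ≡ 0 → ∀ c → c ∉ R
    empty-∉ (true ∷ R) () c
    empty-∉ (false ∷ R) e zero ()
    empty-∉ (false ∷ R) e (suc c) (there c∈R) = empty-∉ R e c c∈R

  root-ok : ∀ {k} (R : Subset (suc k)) → ∣ R ∣ ≡ 1 → rootOf R ∈ R × (∀ c → c ∈ R → c ≡ rootOf R)
  root-ok (true ∷ R) e = here , λ { zero _ → refl ; (suc c) (there c∈R) → ⊥-elim (empty-∉ R (suc-injective e) c c∈R) }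
  root-ok (false ∷ []) ()
  root-ok (false ∷ x ∷ R) e with root-ok (x ∷ R) e
  ... | r∈R , unique = there r∈R , λ { zero () ; (suc c) (there c∈R) → cong suc (unique c c∈R) }

  clamp : (n : ℕ) → ℕ → Fin (suc n)
  clamp zero    _       = zero
  clamp (suc n) zero    = zero
  clamp (suc n) (suc X) = suc (clamp n X)

  toℕ-clamp : ∀ n X → X ≤ n → toℕ (clamp n X) ≡ X
  toℕ-clamp zero    zero    _ = refl
  toℕ-clamp (suc n) zero    _ = refl
  toℕ-clamp (suc n) (suc X) (s≤s X≤n) = cong suc (toℕ-clamp n X X≤n)

  decRightmost : ∀ {n k} (sz : Vec ℕ k) (i : Fin n) c → Dec (Rightmost sz i c)
  decRightmost sz i c =
    ((cum sz c ≤? toℕ i) ×-dec (toℕ i <? cum sz c + lookup sz c)) ×-dec (suc (toℕ i) ≟ cum sz c + lookup sz c)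

  -- For a
  -- canonical array (k = suc k' columns) the row-1 vertices are ordered by their
  -- cyclic key; `Clean t A` says that no redundant row-1 pair has a vertex of
  -- key < t (and, when `cleanRow2` holds, that row 2 has no redundant pair).
  -- `RedAt t A` adds that the vertex of key t is in a redundant pair.
  module Filtration {q k' s : ℕ} (cleanRow2 : Bool) where
    K : ℕ
    K = suc k'

    decRU : ∀ {p} (A : Raw p q K) v → Dec (RightmostUnmarked A v)
    decRU A (inj₁ i) = any? (λ c → decRightmost (Raw.sz1 A) i c ×-dec ¬? (c ∈? Raw.R A))
    decRU A (inj₂ j) = any? (λ c → decRightmost (Raw.sz2 A) j c ×-dec ¬? (c ∈? Raw.R' A))

    decRed : ∀ {p} (A : Raw p q K) v → Dec (Redundant A v)
    decRed A v = (isRow1 v ≟B isRow1 (partner A v)) ×-dec (¬? (decRU A v) ×-dec ¬? (decRU A (partner A v)))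

    rootEnd : ∀ {p} → Raw p q K → ℕ
    rootEnd A = End (Raw.sz1 A) (rootOf (Raw.R A))

    key : ∀ {p} → Raw p q K → Fin p → ℕ
    key {p} A z = keyℕ p (rootEnd A) (toℕ z)

    Clean : ∀ {p} → ℕ → Raw p q K → Set
    Clean {p} t A = Canonical p q s K A
                  × (∀ z → key A z < t → Redundant A (inj₁ z) → ⊥)
                  × (cleanRow2 ≡ true → ∀ j → Redundant A (inj₂ j) → ⊥)

    RedAt : ∀ {p} → ℕ → Raw p q K → Set
    RedAt {p} t A = Clean t A × Σ (Fin p) (λ z → key A z ≡ t × Redundant A (inj₁ z))

    rootEnd≤p : ∀ {p} (A : Raw p q K) → Canonical p q s K A → rootEnd A ≤ p
    rootEnd≤p A c = subst (_ ≤_) (IsPairedArray.rowSum1 (proj₁ c)) (End-le-sum (Raw.sz1 A) _)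

    key-inj-A : ∀ {p} (A : Raw p q K) → Canonical p q s K A → ∀ z z' → key A z ≡ key A z' → z ≡ z'
    key-inj-A {p} A c z z' e = toℕ-injective (key-inj p _ _ _ (toℕ<n z) (toℕ<n z') (rootEnd≤p A c) e)

    key-bound-A : ∀ {p} (A : Raw p q K) → Canonical p q s K A → ∀ z → key A z < p
    key-bound-A {p} A c z = key-bound p _ _ (toℕ<n z) (rootEnd≤p A c)

    clean-weaken : ∀ {p} t (A : Raw p q K) → Clean (suc t) A → Clean t A
    clean-weaken t A (c , nr , nr2) = c , (λ z l → nr z (m<n⇒m<1+n l)) , nr2

    clean-suc-disjoint : ∀ {p} t (A : Raw p q K) → Clean (suc t) A → RedAt t A → ⊥
    clean-suc-disjoint t A (c , nr , nr2) (_ , z , kz , red) = nr z (subst (_< suc t) (sym kz) (n<1+n t)) red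

    clean-split : ∀ {p} t → t < p → (A : Raw p q K) → Clean t A → Clean (suc t) A ⊎ RedAt t A
    clean-split {p} t t<p A g@(c , nr , nr2) with key-surj p (rootEnd A) t t<p (rootEnd≤p A c)
    ... | X , X<p , kX with decRed A (inj₁ (fromℕ< X<p))
    ...   | yes red = inj₂ (g , fromℕ< X<p , keyX , red)
      where
      keyX : key A (fromℕ< X<p) ≡ t
      keyX = trans (cong (keyℕ p (rootEnd A)) (toℕ-fromℕ< X<p)) kX
    ...   | no ¬red = inj₁ (c , nr' , nr2)
      where
      nr' : ∀ z → key A z < suc t → Redundant A (inj₁ z) → ⊥
      nr' z l red with m≤n⇒m<n∨m≡n (≤-pred l)
      ... | inj₁ lt = nr z lt red
      ... | inj₂ eq = ¬red (subst (λ w → Redundant A (inj₁ w))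
                        (key-inj-A A c z (fromℕ< X<p) (trans eq (sym (trans (cong (keyℕ p (rootEnd A)) (toℕ-fromℕ< X<p)) kX)))) red)

    -- all keys are below p, so the filtration is constant from p on
    clean-full : ∀ {p} t → p ≤ t → (A : Raw p q K) → Clean p A → Clean t A
    clean-full t p≤t A (c , nr , nr2) = c , (λ z _ → nr z (key-bound-A A c z)) , nr2

    clean-restrict : ∀ {p} t → p ≤ t → (A : Raw p q K) → Clean t A → Clean p A
    clean-restrict t p≤t A (c , nr , nr2) = c , (λ z l → nr z (<-≤-trans l p≤t)) , nr2

module StageInsertion where
  open CellLayout
  open CyclicKeys
  open PairExtension
  open PairInsertion
  open Stages

  -- Inserting a redundant row-1 pair into an array B with `Clean t B`: the
  -- vertex v receives key t and its partner w key t + j + 1 (j ≤ n - t), both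
  -- placed so that they are not rightmost in an unmarked cell.
  module Insert {q k' s : ℕ} (cleanRow2 : Bool) where
    open Filtration {q} {k'} {s} cleanRow2 public

    rB : ∀ {n} → Raw n q K → Fin K
    rB B = rootOf (Raw.R B)

    -- place of w, chosen in B by its key t + j
    posW : ∀ {n} → ℕ → Raw n q K → ℕ → ℕ
    posW {n} t B j = insPos n (rootEnd B) (t + j)

    cellW : ∀ {n} → ℕ → Raw n q K → ℕ → Fin K
    cellW {n} t B j = insCell (Raw.sz1 B) (rB B) n (rootEnd B) (t + j)

    sizesW : ∀ {n} → ℕ → Raw n q K → ℕ → Vec ℕ K
    sizesW t B j = incr (cellW t B j) (Raw.sz1 B)

    -- place of v, chosen after inserting w by its key t
    posV : ∀ {n} → ℕ → Raw n q K → ℕ → ℕ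
    posV {n} t B j = insPos (suc n) (End (sizesW t B j) (rB B)) t

    cellV : ∀ {n} → ℕ → Raw n q K → ℕ → Fin K
    cellV {n} t B j = insCell (sizesW t B j) (rB B) (suc n) (End (sizesW t B j) (rB B)) t

    ins : ∀ {n} → ℕ → Raw n q K → ℕ → Raw (suc (suc n)) q K
    ins {n} t B j = insertPair B (clamp n (posW t B j)) (cellW t B j) (clamp (suc n) (posV t B j)) (cellV t B j)

    module InsFacts {n} (t : ℕ) (B : Raw n q K) (j : ℕ) (tj≤n : t + j ≤ n) (cleanB : Clean t B) where
      canonB : Canonical n q s K B
      canonB = proj₁ cleanB

      sumB : sum (Raw.sz1 B) ≡ n
      sumB = IsPairedArray.rowSum1 (proj₁ canonB)

      module PlaceW = InsChoice (Raw.sz1 B) (rB B) sumB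

      goodW : PlaceW.Good (t + j) (posW t B j) (cellW t B j)
      goodW = PlaceW.exists (t + j) tj≤n

      xw : Fin (suc n)
      xw = clamp n (posW t B j)

      toℕ-xw : toℕ xw ≡ posW t B j
      toℕ-xw = toℕ-clamp n _ (subst (posW t B j ≤_) sumB (≤-trans (PlaceW.Good.ghi goodW) (End-le-sum (Raw.sz1 B) (cellW t B j))))

      cw : Fin K
      cw = cellW t B j

      V1 : ValidIns (Raw.sz1 B) xw cw
      V1 = vi (subst (cum (Raw.sz1 B) cw ≤_) (sym toℕ-xw) (PlaceW.Good.glo goodW))
              (subst (_≤ End (Raw.sz1 B) cw) (sym toℕ-xw) (PlaceW.Good.ghi goodW))

      sL : Vec ℕ K
      sL = sizesW t B j

      sumL : sum sL ≡ suc n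
      sumL = trans (sum-incr cw (Raw.sz1 B)) (cong suc sumB)

      module PlaceV = InsChoice sL (rB B) sumL

      goodV : PlaceV.Good t (posV t B j) (cellV t B j)
      goodV = PlaceV.exists t (≤-trans (m≤m+n t j) (m≤n⇒m≤1+n tj≤n))

      xv : Fin (suc (suc n))
      xv = clamp (suc n) (posV t B j)

      toℕ-xv : toℕ xv ≡ posV t B j
      toℕ-xv = toℕ-clamp (suc n) _ (subst (posV t B j ≤_) sumL (≤-trans (PlaceV.Good.ghi goodV) (End-le-sum sL (cellV t B j))))

      cv : Fin K
      cv = cellV t B j

      V2 : ValidIns sL xv cv
      V2 = vi (subst (cum sL cv ≤_) (sym toℕ-xv) (PlaceV.Good.glo goodV))
              (subst (_≤ End sL cv) (sym toℕ-xv) (PlaceV.Good.ghi goodV))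

      -- the only marked row-1 cell is the root
      ∉R⇒≢root : ∀ c → c ∉ Raw.R B → c ≢ rB B
      ∉R⇒≢root c c∉R c≡r = c∉R (subst (_∈ Raw.R B) (sym c≡r) (proj₁ (root-ok (Raw.R B) (proj₁ (proj₂ canonB)))))

      nr1 : cw ∉ Raw.R B → toℕ xw ≡ End (Raw.sz1 B) cw → ⊥
      nr1 c∉R eq = <-irrefl (trans (sym toℕ-xw) eq) (PlaceW.Good.gnr goodW (∉R⇒≢root cw c∉R))

      nr2 : cv ∉ Raw.R B → toℕ xv ≡ End sL cv → ⊥
      nr2 c∉R eq = <-irrefl (trans (sym toℕ-xv) eq) (PlaceV.Good.gnr goodV (∉R⇒≢root cv c∉R))

      A : Raw (suc (suc n)) q K
      A = ins t B j

      E : Ext B A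
      E = InsertPairFacts.ext-ok B xw cw xv cv V1 V2 nr1 nr2

      module EF = ExtFacts E

      canonA : Canonical (suc (suc n)) q s K A
      canonA = EF.forward (proj₁ canonB) (trans (sum-incr cv sL) (cong suc sumL)) , proj₂ canonB

      module KeyW = KeyIns (Raw.sz1 B) xw cw V1 (rB B) sumB
      module KeyV = KeyIns sL xv cv V2 (rB B) sumL

      κw≡ : KeyW.κ ≡ t + j
      κw≡ = trans (cong (insKey (rB B) cw n (rootEnd B)) toℕ-xw) (PlaceW.Good.gkey goodW)

      κv≡ : KeyV.κ ≡ t
      κv≡ = trans (cong (insKey (rB B) cv (suc n) (End sL (rB B))) toℕ-xv) (PlaceV.Good.gkey goodV)

      key-xv : key A xv ≡ t
      key-xv = trans KeyV.key-new κv≡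

      key-σ : ∀ y → key A (σf xv xw y) ≡ pIn t (pIn (t + j) (key B y))
      key-σ y = trans (KeyV.key-old (punchIn xw y))
                      (cong₂ pIn κv≡ (trans (KeyW.key-old y) (cong (λ κ → pIn κ (key B y)) κw≡)))

      key-b : key A EF.b ≡ suc (t + j)
      key-b = trans (KeyV.key-old xw) (trans (cong₂ pIn κv≡ (trans KeyW.key-new κw≡)) (pIn-ge t (t + j) (m≤m+n t j)))

      cell-xv : InCell (Raw.sz1 A) xv cv
      cell-xv = Insertion.cell-new sL xv cv V2

      cell-b : InCell (Raw.sz1 A) EF.b cw
      cell-b = Insertion.cell-fwd sL xv cv V2 xw cw (Insertion.cell-new (Raw.sz1 B) xw cw V1)

      below-t : ∀ v → pIn t (pIn (t + j) v) < t → v < t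
      below-t v l with lt-or-ge v t
      ... | inj₁ v<t = v<t
      ... | inj₂ t≤v = ⊥-elim (<⇒≱ l (≤-trans t≤v (≤-trans (pIn-≥ (t + j) v) (pIn-≥ t _))))

      redAtA : RedAt t A
      redAtA = (canonA , nrA , nr2A) , xv , key-xv , EF.red-a
        where
        nrA : ∀ z → key A z < t → Redundant A (inj₁ z) → ⊥
        nrA z l red with classify2 xv xw z
        ... | inj₁ refl = <-irrefl key-xv l
        ... | inj₂ (inj₁ refl) = <⇒≱ l (≤-trans (m≤m+n t j) (≤-trans (n≤1+n _) (≤-reflexive (sym key-b))))
        ... | inj₂ (inj₂ (y , refl)) =
              proj₁ (proj₂ cleanB) y (below-t _ (subst (_< t) (key-σ y) l)) (EF.red← (inj₁ y) red)
        nr2A : cleanRow2 ≡ true → ∀ j → Redundant A (inj₂ j) → ⊥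
        nr2A f j red = proj₂ (proj₂ cleanB) f j (EF.red← (inj₂ j) red)

module InsertionBijection where
  open CellLayout
  open CyclicKeys
  open PairExtension
  open PairInsertion
  open Stages
  open StageInsertion

  insertPair-cong : ∀ {n q K} (B : Raw n q K) {xw xw' cw cw' xv xv' cv cv'} →
    xw ≡ xw' → cw ≡ cw' → xv ≡ xv' → cv ≡ cv' → insertPair B xw cw xv cv ≡ insertPair B xw' cw' xv' cv'
  insertPair-cong B refl refl refl refl = refl

  module Bijection {q k' s : ℕ} (cleanRow2 : Bool) where
    open Insert {q} {k'} {s} cleanRow2 public

    -- Injectivity: the inserted pair is recovered from A as the vertex of key t
    -- and its partner, whose key determines j.
    ins-inj : ∀ {n} t (B B' : Raw n q K) j j' (tj : t + j ≤ n) (tj' : t + j' ≤ n)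
      (cB : Clean t B) (cB' : Clean t B') → ins t B j ≡ ins t B' j' → B ≡ B' × j ≡ j'
    ins-inj {n} t B B' j j' tj tj' cB cB' eq = B≡B' , j≡j'
      where
      module F1 = InsFacts t B j tj cB
      module F2 = InsFacts t B' j' tj' cB'
      A : Raw (suc (suc n)) q K
      A = F1.A
      xv≡ : F1.xv ≡ F2.xv
      xv≡ = key-inj-A A F1.canonA F1.xv F2.xv (trans F1.key-xv (sym (trans (cong (λ X → key X F2.xv) eq) F2.key-xv)))
      b≡ : F1.EF.b ≡ F2.EF.b
      b≡ = inj₁-injective (trans (sym (Ext.pa F1.E))
             (trans (cong (λ z → partner A (inj₁ z)) xv≡) (trans (cong (λ X → partner X (inj₁ F2.xv)) eq) (Ext.pa F2.E))))
      j≡j' : j ≡ j'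
      j≡j' = +-cancelˡ-≡ t j j' (suc-injective
               (trans (sym F1.key-b) (trans (cong (key A) b≡) (trans (cong (λ X → key X F2.EF.b) eq) F2.key-b))))
      xw≡ : F1.xw ≡ F2.xw
      xw≡ = punchIn-injective F2.xv _ _ (trans (cong (λ z → punchIn z F1.xw) (sym xv≡)) b≡)
      cv≡ : F1.cv ≡ F2.cv
      cv≡ = InCell-unique (Raw.sz1 A) F1.xv F1.cv F2.cv F1.cell-xv
              (subst (λ z → InCell (Raw.sz1 A) z F2.cv) (sym xv≡) (subst (λ X → InCell (Raw.sz1 X) F2.xv F2.cv) (sym eq) F2.cell-xv))
      cw≡ : F1.cw ≡ F2.cw
      cw≡ = InCell-unique (Raw.sz1 A) F1.EF.b F1.cw F2.cw F1.cell-b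
              (subst (λ z → InCell (Raw.sz1 A) z F2.cw) (sym b≡) (subst (λ X → InCell (Raw.sz1 X) F2.EF.b F2.cw) (sym eq) F2.cell-b))
      B≡B' : B ≡ B'
      B≡B' = insertPair-inj B B' F1.xw F1.cw F1.xv F1.cv (trans eq (insertPair-cong B' (sym xw≡) (sym cw≡) (sym xv≡) (sym cv≡)))

    -- Surjectivity, first half: if A = insertPair B … with RedAt-shape (Clean t A and
    -- the vertex xv of key t), then B is Clean t and A is `ins t B j` for the j
    -- read off from the key of the partner of xv.
    module FromInsertion {n} (t : ℕ) (B : Raw n q K) (xw : Fin (suc n)) (cw : Fin K)
                (xv : Fin (suc (suc n))) (cv : Fin K)
                (V1 : ValidIns (Raw.sz1 B) xw cw) (V2 : ValidIns (incr cw (Raw.sz1 B)) xv cv)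
                (nr1 : cw ∉ Raw.R B → toℕ xw ≡ End (Raw.sz1 B) cw → ⊥)
                (nr2 : cv ∉ Raw.R B → toℕ xv ≡ End (incr cw (Raw.sz1 B)) cv → ⊥)
                (cleanA : Clean t (insertPair B xw cw xv cv)) (key-xv : key (insertPair B xw cw xv cv) xv ≡ t) where
      A : Raw (suc (suc n)) q K
      A = insertPair B xw cw xv cv

      E : Ext B A
      E = InsertPairFacts.ext-ok B xw cw xv cv V1 V2 nr1 nr2

      module EF = ExtFacts E

      sL : Vec ℕ K
      sL = incr cw (Raw.sz1 B)

      canonA : Canonical (suc (suc n)) q s K A
      canonA = proj₁ cleanA

      sumB : sum (Raw.sz1 B) ≡ n
      sumB = suc-injective (suc-injective (trans (sym (trans (sum-incr cv sL) (cong suc (sum-incr cw (Raw.sz1 B)))))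
               (IsPairedArray.rowSum1 (proj₁ canonA))))

      sumL : sum sL ≡ suc n
      sumL = trans (sum-incr cw (Raw.sz1 B)) (cong suc sumB)

      canonB : Canonical n q s K B
      canonB = EF.backward (proj₁ canonA) sumB , proj₂ canonA

      module KeyW = KeyIns (Raw.sz1 B) xw cw V1 (rB B) sumB
      module KeyV = KeyIns sL xv cv V2 (rB B) sumL

      κv≡ : KeyV.κ ≡ t
      κv≡ = trans (sym KeyV.key-new) key-xv

      key-b : key A EF.b ≡ pIn t KeyW.κ
      key-b = trans (KeyV.key-old xw) (cong₂ pIn κv≡ KeyW.key-new)

      -- the partner of xv is redundant and distinct from xv, so its key is > t
      t≤key-b : t ≤ key A EF.b
      t≤key-b with lt-or-ge (key A EF.b) t
      ... | inj₁ l = ⊥-elim (proj₁ (proj₂ cleanA) EF.b l EF.red-b)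
      ... | inj₂ h = h

      -- so w had key ≥ t already in B, and j is read off from it
      t≤κw : t ≤ KeyW.κ
      t≤κw with lt-or-ge KeyW.κ t
      ... | inj₂ h = h
      ... | inj₁ l = ⊥-elim (EF.b≢a (key-inj-A A canonA EF.b xv (trans key-b≡t (sym key-xv))))
        where
        key-b≡t : key A EF.b ≡ t
        key-b≡t = ≤-antisym (≤-trans (≤-reflexive (trans key-b (pIn-lt t KeyW.κ l))) (<⇒≤ l)) t≤key-b

      j : ℕ
      j = KeyW.κ ∸ t

      t+j≡κw : t + j ≡ KeyW.κ
      t+j≡κw = m+[n∸m]≡n t≤κw

      κw≤n : KeyW.κ ≤ n
      κw≤n = ≤-pred (subst (_< suc n) KeyW.key-new
               (key-bound (suc n) (End sL (rB B)) (toℕ xw) (toℕ<n xw) (subst (End sL (rB B) ≤_) sumL (End-le-sum sL (rB B)))))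

      tj≤n : t + j ≤ n
      tj≤n = subst (_≤ n) (sym t+j≡κw) κw≤n

      ≢root⇒∉R : ∀ c → c ≢ rB B → c ∉ Raw.R B
      ≢root⇒∉R c c≢r c∈R = c≢r (proj₂ (root-ok (Raw.R B) (proj₁ (proj₂ canonB))) c c∈R)

      -- the given places are the good places of the keys t + j and t …
      module PlaceW = InsChoice (Raw.sz1 B) (rB B) sumB
      module PlaceV = InsChoice sL (rB B) sumL

      goodW : PlaceW.Good (t + j) (toℕ xw) cw
      goodW = record { glo = ValidIns.lo V1 ; ghi = ValidIns.hi V1 ; gkey = sym t+j≡κw
                     ; gnr = λ c≢r → ≤∧≢⇒< (ValidIns.hi V1) (nr1 (≢root⇒∉R cw c≢r)) }

      goodV : PlaceV.Good t (toℕ xv) cv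
      goodV = record { glo = ValidIns.lo V2 ; ghi = ValidIns.hi V2 ; gkey = κv≡
                     ; gnr = λ c≢r → ≤∧≢⇒< (ValidIns.hi V2) (nr2 (≢root⇒∉R cv c≢r)) }

      -- … hence the places chosen by `ins`
      cw≡ : cw ≡ cellW t B j
      cw≡ = proj₂ (PlaceW.unique (t + j) (toℕ xw) cw goodW)

      xw≡ : xw ≡ clamp n (posW t B j)
      xw≡ = toℕ-injective (trans posW≡ (sym (toℕ-clamp n _ (subst (_≤ n) posW≡ (≤-pred (toℕ<n xw))))))
        where
        posW≡ : toℕ xw ≡ posW t B j
        posW≡ = proj₁ (PlaceW.unique (t + j) (toℕ xw) cw goodW)

      sL≡ : sL ≡ sizesW t B j
      sL≡ = cong (λ c → incr c (Raw.sz1 B)) cw≡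

      posV≡ : toℕ xv ≡ posV t B j
      posV≡ = trans (proj₁ (PlaceV.unique t (toℕ xv) cv goodV)) (cong (λ s' → insPos (suc n) (End s' (rB B)) t) sL≡)

      xv≡ : xv ≡ clamp (suc n) (posV t B j)
      xv≡ = toℕ-injective (trans posV≡ (sym (toℕ-clamp (suc n) _ (subst (_≤ suc n) posV≡ (≤-pred (toℕ<n xv))))))

      cv≡ : cv ≡ cellV t B j
      cv≡ = trans (proj₂ (PlaceV.unique t (toℕ xv) cv goodV)) (cong (λ s' → insCell s' (rB B) (suc n) (End s' (rB B)) t) sL≡)

      ins≡ : ins t B j ≡ A
      ins≡ = sym (insertPair-cong B xw≡ cw≡ xv≡ cv≡)

      cleanB : Clean t B
      cleanB = canonB , nrB , nr2B
        where
        nrB : ∀ y → key B y < t → Redundant B (inj₁ y) → ⊥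
        nrB y l red = proj₁ (proj₂ cleanA) (σf xv xw y)
          (subst (_< t) (sym (trans (KeyV.key-old (punchIn xw y)) (cong₂ pIn κv≡ (trans (KeyW.key-old y)
              (pIn-lt KeyW.κ (key B y) (<-≤-trans l t≤κw))))))
            (subst (_< t) (sym (pIn-lt t (key B y) l)) l))
          (EF.red→ (inj₁ y) red)
        nr2B : cleanRow2 ≡ true → ∀ j → Redundant B (inj₂ j) → ⊥
        nr2B f j red = proj₂ (proj₂ cleanA) f j (EF.red→ (inj₂ j) red)

    row1-of : ∀ {p} (v : Vertex p q) → true ≡ isRow1 v → Σ (Fin p) (λ w → v ≡ inj₁ w)
    row1-of (inj₁ w) _ = w , refl

    -- Surjectivity, second half: removing the redundant pair {v, w} through
    -- the vertex v of key t from A with RedAt t A gives B with A = insertPair B ….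
    module Removal {n} (t : ℕ) (A : Raw (suc (suc n)) q K) (redAtA : RedAt t A) where
      cleanA : Clean t A
      cleanA = proj₁ redAtA

      open IsPairedArray (proj₁ (proj₁ cleanA)) using (involutive; noFixed; rowSum1)

      xv : Fin (suc (suc n))
      xv = proj₁ (proj₂ redAtA)

      red-xv : Redundant A (inj₁ xv)
      red-xv = proj₂ (proj₂ (proj₂ redAtA))

      w : Fin (suc (suc n))
      w = proj₁ (row1-of (partner A (inj₁ xv)) (proj₁ red-xv))

      pa : partner A (inj₁ xv) ≡ inj₁ w
      pa = proj₂ (row1-of (partner A (inj₁ xv)) (proj₁ red-xv))

      pb : partner A (inj₁ w) ≡ inj₁ xv
      pb = trans (cong (partner A) (sym pa)) (involutive (inj₁ xv))

      xv≢w : xv ≢ w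
      xv≢w e = noFixed (inj₁ xv) (trans pa (cong inj₁ (sym e)))

      xw : Fin (suc n)
      xw = punchOut xv≢w

      b≡w : punchIn xv xw ≡ w
      b≡w = punchIn-punchOut xv≢w

      cellOf : (z : Fin (suc (suc n))) → Σ (Fin K) (λ c → InCell (Raw.sz1 A) z c)
      cellOf z = colOf (Raw.sz1 A) (toℕ z) , colOf-cell (Raw.sz1 A) (toℕ z) (subst (toℕ z <_) (sym rowSum1) (toℕ<n z))

      cv : Fin K
      cv = proj₁ (cellOf xv)

      L : Vec ℕ K
      L = decr cv (Raw.sz1 A)

      L≡ : incr cv L ≡ Raw.sz1 A
      L≡ = incr-decr cv (Raw.sz1 A) (InCell⇒nonempty (Raw.sz1 A) xv cv (proj₂ (cellOf xv)))

      V2L : ValidIns L xv cv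
      V2L = valid-from-cell L xv cv (subst (λ s' → InCell s' xv cv) (sym L≡) (proj₂ (cellOf xv)))

      cw : Fin K
      cw = proj₁ (cellOf w)

      cell-xw : InCell L xw cw
      cell-xw = Insertion.cell-bwd L xv cv V2L xw cw
        (subst (λ s' → InCell s' (punchIn xv xw) cw) (sym L≡) (subst (λ z → InCell (Raw.sz1 A) z cw) (sym b≡w) (proj₂ (cellOf w))))

      sB : Vec ℕ K
      sB = decr cw L

      sB≡ : incr cw sB ≡ L
      sB≡ = incr-decr cw L (InCell⇒nonempty L xw cw cell-xw)

      V1 : ValidIns sB xw cw
      V1 = valid-from-cell sB xw cw (subst (λ s' → InCell s' xw cw) (sym sB≡) cell-xw)

      V2 : ValidIns (incr cw sB) xv cv
      V2 = subst (λ s' → ValidIns s' xv cv) (sym sB≡) V2L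

      sA≡ : Raw.sz1 A ≡ incr cv (incr cw sB)
      sA≡ = trans (sym L≡) (cong (incr cv) (sym sB≡))

      preim : ∀ (v : Vertex (suc (suc n)) q) → v ≢ inj₁ xv → v ≢ inj₁ (punchIn xv xw) →
        Σ (Vertex n q) (λ u → v ≡ σV xv xw u)
      preim (inj₂ j) _ _ = inj₂ j , refl
      preim (inj₁ z) ≢a ≢b with classify2 xv xw z
      ... | inj₁ refl = ⊥-elim (≢a refl)
      ... | inj₂ (inj₁ refl) = ⊥-elim (≢b refl)
      ... | inj₂ (inj₂ (y , refl)) = inj₁ y , refl

      σ̂≢xv : ∀ (u : Vertex n q) → σV xv xw u ≢ inj₁ xv
      σ̂≢xv (inj₁ y) e = punchInᵢ≢i xv _ (inj₁-injective e)
      σ̂≢xv (inj₂ j) ()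

      σ̂≢w : ∀ (u : Vertex n q) → σV xv xw u ≢ inj₁ w
      σ̂≢w (inj₁ y) e = punchInᵢ≢i xw y (punchIn-injective xv _ _ (trans (inj₁-injective e) (sym b≡w)))
      σ̂≢w (inj₂ j) ()

      partner-of-old : ∀ (u : Vertex n q) → Σ (Vertex n q) (λ u' → partner A (σV xv xw u) ≡ σV xv xw u')
      partner-of-old u = preim (partner A (σV xv xw u)) ≢a ≢b
        where
        ≢a : partner A (σV xv xw u) ≢ inj₁ xv
        ≢a e = σ̂≢w u (trans (trans (sym (involutive _)) (cong (partner A) e)) pa)
        ≢b : partner A (σV xv xw u) ≢ inj₁ (punchIn xv xw)
        ≢b e = σ̂≢xv u (trans (trans (sym (involutive _)) (cong (partner A) (trans e (cong inj₁ b≡w)))) pb)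

      B : Raw n q K
      B = mkRaw sB (Raw.sz2 A) (tabulate (λ y → proj₁ (partner-of-old (inj₁ y))))
                               (tabulate (λ j → proj₁ (partner-of-old (inj₂ j)))) (Raw.R A) (Raw.R' A)

      pσ : ∀ u → partner A (σV xv xw u) ≡ σV xv xw (partner B u)
      pσ (inj₁ y) = trans (proj₂ (partner-of-old (inj₁ y)))
                          (cong (σV xv xw) (sym (lookup∘tabulate (λ y → proj₁ (partner-of-old (inj₁ y))) y)))
      pσ (inj₂ j) = trans (proj₂ (partner-of-old (inj₂ j)))
                          (cong (σV xv xw) (sym (lookup∘tabulate (λ j → proj₁ (partner-of-old (inj₂ j))) j)))

      A≡ : A ≡ insertPair B xw cw xv cv
      A≡ = insertPair-char B A xw cw xv cv sA≡ refl refl refl pσ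
             (trans pa (cong inj₁ (sym b≡w)))
             (trans (cong (λ z → partner A (inj₁ z)) b≡w) pb)

      -- v and w are not rightmost in unmarked cells, since the pair is redundant
      nr2 : cv ∉ Raw.R B → toℕ xv ≡ End (incr cw sB) cv → ⊥
      nr2 c∉R e = proj₁ (proj₂ red-xv)
        (cv , subst (λ s' → Rightmost s' xv cv) (sym sA≡) (rm-at-end (incr cw sB) xv cv V2 e) , c∉R)

      nr1 : cw ∉ Raw.R B → toℕ xw ≡ End sB cw → ⊥
      nr1 c∉R e = proj₂ (proj₂ red-xv) (subst (RightmostUnmarked A) (sym pa)
        (cw , subst₂ (λ s' z → Rightmost s' z cw) (sym sA≡) b≡w
                (Insertion.rm-fwd (incr cw sB) xv cv V2 xw cw (rm-at-end sB xw cw V1 e)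
                   (λ c≡ ex → nr2 (subst (_∉ Raw.R B) c≡ c∉R) ex)) , c∉R))

      module Inv = FromInsertion t B xw cw xv cv V1 V2 nr1 nr2
                     (subst (Clean t) A≡ cleanA) (subst (λ X → key X xv ≡ t) A≡ (proj₁ (proj₂ (proj₂ redAtA))))

    surj : ∀ {n} t (A : Raw (suc (suc n)) q K) → RedAt t A →
      Σ (Raw n q K × Fin (suc n ∸ t)) (λ Bj → Clean t (proj₁ Bj) × ins t (proj₁ Bj) (toℕ (proj₂ Bj)) ≡ A)
    surj {n} t A redAtA = (R.B , fromℕ< j<) , Inv.cleanB ,
                          trans (cong (ins t R.B) (toℕ-fromℕ< j<)) (trans Inv.ins≡ (sym R.A≡))
      where
      module R = Removal t A redAtA
      module Inv = R.Inv
      j< : Inv.j < suc n ∸ t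
      j< = subst (Inv.j <_) (sym (suc∸ n t (≤-trans (m≤m+n t Inv.j) Inv.tj≤n)))
             (s≤s (subst (_≤ n ∸ t) (m+n∸m≡n t Inv.j) (∸-monoˡ-≤ t Inv.tj≤n)))

module Binomial where
  Σ< : ℕ → (ℕ → ℕ) → ℕ
  Σ< zero    f = 0
  Σ< (suc m) f = f 0 + Σ< m (λ i → f (suc i))

  Σ<-cong : ∀ m (f g : ℕ → ℕ) → (∀ i → f i ≡ g i) → Σ< m f ≡ Σ< m g
  Σ<-cong zero    f g f≗g = refl
  Σ<-cong (suc m) f g f≗g = cong₂ _+_ (f≗g 0) (Σ<-cong m _ _ (λ i → f≗g (suc i)))

  Σ<-+ : ∀ m (f g : ℕ → ℕ) → Σ< m (λ i → f i + g i) ≡ Σ< m f + Σ< m g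
  Σ<-+ zero    f g = refl
  Σ<-+ (suc m) f g rewrite Σ<-+ m (λ i → f (suc i)) (λ i → g (suc i)) =
    shuffle (f 0) (g 0) (Σ< m (λ i → f (suc i))) (Σ< m (λ i → g (suc i)))
    where
    shuffle : ∀ a b c d → a + b + (c + d) ≡ a + c + (b + d)
    shuffle = solve-∀

  Σ<-* : ∀ m c (f : ℕ → ℕ) → Σ< m (λ i → c * f i) ≡ c * Σ< m f
  Σ<-* zero    c f = sym (*-zeroʳ c)
  Σ<-* (suc m) c f rewrite Σ<-* m c (λ i → f (suc i)) = sym (*-distribˡ-+ c (f 0) _)

  Σ<-drop-last : ∀ m (f : ℕ → ℕ) → f m ≡ 0 → Σ< (suc m) f ≡ Σ< m f
  Σ<-drop-last zero    f f0≡0 = trans (+-identityʳ (f 0)) f0≡0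
  Σ<-drop-last (suc m) f fm≡0 = cong (f 0 +_) (Σ<-drop-last m (λ i → f (suc i)) fm≡0)

  sumUpTo≡Σ< : ∀ n f → sumUpTo n f ≡ Σ< (suc n) f
  sumUpTo≡Σ< n f = go (suc n) (λ i → i)
    where
    go : ∀ m (g : ℕ → ℕ) → lsum (map f (applyUpTo g m)) ≡ Σ< m (λ i → f (g i))
    go zero    g = refl
    go (suc m) g = cong (f (g 0) +_) (go m (λ i → g (suc i)))

  absorb : ∀ m k → (suc m C suc k) * suc k ≡ suc m * (m C k)
  absorb zero    zero    = refl
  absorb zero    (suc k) = refl
  absorb (suc m) zero    = trans (*-identityʳ _) (trans (nC1≡n (suc (suc m))) (sym (*-identityʳ (suc (suc m)))))
  absorb (suc m) (suc k) =
    begin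
      (suc (suc m) C suc (suc k)) * suc (suc k)
    ≡⟨ cong (_* suc (suc k)) (sym (nCk+nC[k+1]≡[n+1]C[k+1] (suc m) (suc k))) ⟩
      ((suc m C suc k) + (suc m C suc (suc k))) * suc (suc k)
    ≡⟨ expand (suc m C suc k) (suc m C suc (suc k)) k ⟩
      (suc m C suc k) * suc k + (suc m C suc k) + (suc m C suc (suc k)) * suc (suc k)
    ≡⟨ cong₂ (λ x y → x + (suc m C suc k) + y) (absorb m k) (absorb m (suc k)) ⟩
      suc m * (m C k) + (suc m C suc k) + suc m * (m C suc k)
    ≡⟨ collect (suc m) (m C k) (m C suc k) (suc m C suc k) ⟩
      suc m * ((m C k) + (m C suc k)) + (suc m C suc k)
    ≡⟨ cong (λ x → suc m * x + (suc m C suc k)) (nCk+nC[k+1]≡[n+1]C[k+1] m k) ⟩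
      suc m * (suc m C suc k) + (suc m C suc k)
    ≡⟨ +-comm (suc m * (suc m C suc k)) _ ⟩
      suc (suc m) * (suc m C suc k)
    ∎
    where
    open ≡-Reasoning
    expand : ∀ a b k → (a + b) * suc (suc k) ≡ a * suc k + a + b * suc (suc k)
    expand = solve-∀
    collect : ∀ s x y z → s * x + z + s * y ≡ s * (x + y) + z
    collect = solve-∀

  two-suc : ∀ i → 2 * suc i ≡ suc (suc (2 * i))
  two-suc = solve-∀

  -- The closed form S d p = Σ_i (d C 2i)(2i-1)!! N(p - 2i): the number of ways
  -- to choose i pairs among d elements, times N of what is left.
  module ClosedForm (N : ℕ → ℕ) where
    term : ℕ → ℕ → ℕ → ℕ
    term d p i = (d C (2 * i)) * dfact i * N (p ∸ 2 * i)

    S : ℕ → ℕ → ℕ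
    S d p = Σ< (suc d) (term d p)

    S0 : ∀ p → S 0 p ≡ N p
    S0 p = trans (+-identityʳ _) (+-identityʳ (N p))

    S1 : ∀ p → S 1 p ≡ N p
    S1 p = trans (cong (_+ (term 1 p 1 + 0)) (+-identityʳ (N p))) (+-identityʳ (N p))

    term0 : ∀ d p → term d p 0 ≡ N p
    term0 d p = +-identityʳ (N p)

    term-big : ∀ d p i → d < 2 * i → term d p i ≡ 0
    term-big d p i d<2i rewrite k>n⇒nCk≡0 d<2i = refl

    -- Pascal's rule for the terms: either the last of the d+2 elements is
    -- unpaired, or it is paired with one of the other d+1 (absorption).
    term-step : ∀ d' n i → term (suc (suc d')) (suc (suc n)) (suc i)
                          ≡ term (suc d') (suc (suc n)) (suc i) + suc d' * term d' n i
    term-step d' n i =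
      begin
        (suc (suc d') C (2 * suc i)) * dfact (suc i) * N (suc (suc n) ∸ 2 * suc i)
      ≡⟨ cong₂ (λ x y → (suc (suc d') C x) * dfact (suc i) * N (suc (suc n) ∸ y)) (two-suc i) (two-suc i) ⟩
        (suc (suc d') C suc (suc (2 * i))) * dfact (suc i) * N (n ∸ 2 * i)
      ≡⟨ cong (λ x → x * dfact (suc i) * N (n ∸ 2 * i)) (sym (nCk+nC[k+1]≡[n+1]C[k+1] (suc d') (suc (2 * i)))) ⟩
        (a + b) * ((1 + 2 * i) * dfact i) * N (n ∸ 2 * i)
      ≡⟨ distribute a b (2 * i) (dfact i) (N (n ∸ 2 * i)) ⟩
        b * ((1 + 2 * i) * dfact i) * N (n ∸ 2 * i) + (a * suc (2 * i)) * (dfact i * N (n ∸ 2 * i))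
      ≡⟨ cong₂ (λ x y → (suc d' C x) * dfact (suc i) * N (n ∸ 2 * i) + y * (dfact i * N (n ∸ 2 * i)))
               (sym (two-suc i)) (absorb d' (2 * i)) ⟩
        (suc d' C (2 * suc i)) * dfact (suc i) * N (n ∸ 2 * i) + suc d' * (d' C (2 * i)) * (dfact i * N (n ∸ 2 * i))
      ≡⟨ cong₂ _+_ (cong (λ y → (suc d' C (2 * suc i)) * dfact (suc i) * N (suc (suc n) ∸ y)) (sym (two-suc i)))
                   (reassoc (suc d') (d' C (2 * i)) (dfact i) (N (n ∸ 2 * i))) ⟩
        term (suc d') (suc (suc n)) (suc i) + suc d' * term d' n i
      ∎
      where
      open ≡-Reasoning
      a b : ℕ
      a = suc d' C suc (2 * i)
      b = suc d' C suc (suc (2 * i))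
      distribute : ∀ a b k f x → (a + b) * ((1 + k) * f) * x ≡ b * ((1 + k) * f) * x + (a * suc k) * (f * x)
      distribute = solve-∀
      reassoc : ∀ s c f x → s * c * (f * x) ≡ s * (c * f * x)
      reassoc = solve-∀

    -- The recurrence matching Clean t = Clean (t+1) ⊎ RedAt t.
    S-rec : ∀ d' n → S (suc (suc d')) (suc (suc n)) ≡ S (suc d') (suc (suc n)) + S d' n * suc d'
    S-rec d' n =
      begin
        term d2 p 0 + Σ< (suc d1) (λ i → term d2 p (suc i))
      ≡⟨ cong₂ _+_ (term0 d2 p) (Σ<-cong (suc d1) _ _ (term-step d' n)) ⟩
        N p + Σ< (suc d1) (λ i → term d1 p (suc i) + suc d' * term d' n i)
      ≡⟨ cong (N p +_) (Σ<-+ (suc d1) (λ i → term d1 p (suc i)) (λ i → suc d' * term d' n i)) ⟩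
        N p + (Σ< (suc d1) (λ i → term d1 p (suc i)) + Σ< (suc d1) (λ i → suc d' * term d' n i))
      ≡⟨ cong₂ (λ x y → N p + (x + y))
           (Σ<-drop-last d1 (λ i → term d1 p (suc i)) (term-big d1 p (suc d1) (≤-trans (n<1+n d1) (m≤m+n (suc d1) _))))
           (trans (Σ<-* (suc d1) (suc d') (term d' n))
                  (cong (suc d' *_) (Σ<-drop-last d1 (term d' n) (term-big d' n d1 (≤-trans (n<1+n d') (m≤m+n d1 _)))))) ⟩
        N p + (Σ< d1 (λ i → term d1 p (suc i)) + suc d' * S d' n)
      ≡⟨ regroup (N p) _ (suc d') (S d' n) ⟩
        N p + Σ< d1 (λ i → term d1 p (suc i)) + S d' n * suc d'
      ≡⟨ cong (λ x → x + Σ< d1 (λ i → term d1 p (suc i)) + S d' n * suc d') (sym (term0 d1 p)) ⟩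
        term d1 p 0 + Σ< d1 (λ i → term d1 p (suc i)) + S d' n * suc d'
      ∎
      where
      open ≡-Reasoning
      d1 d2 p : ℕ
      d1 = suc d'
      d2 = suc (suc d')
      p  = suc (suc n)
      regroup : ∀ a b c e → a + (b + c * e) ≡ a + b + e * c
      regroup = solve-∀

module StageCount where
  open Counting
  open CyclicKeys using (suc∸)
  open Stages
  open StageInsertion
  open InsertionBijection
  open Binomial

  private
    +-<-∸ : ∀ x m t → x < m ∸ t → t + x < m
    +-<-∸ x m zero x< = x<
    +-<-∸ x (suc m) (suc t) x< = s≤s (+-<-∸ x m t x<)

  module Count {q k' s : ℕ} (cleanRow2 : Bool) where
    open Bijection {q} {k'} {s} cleanRow2

    no-redAt-1 : ∀ t (A : Raw 1 q K) → RedAt t A → ⊥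
    no-redAt-1 t A ((c , _) , zero , _ , (same , _)) with row1-of (partner A (inj₁ zero)) same
    ... | zero , e = IsPairedArray.noFixed (proj₁ c) (inj₁ zero) e

    count-redAt : ∀ {n} t {a} → IsCount a (λ (B : Raw n q K) → Clean t B) →
      IsCount (a * (suc n ∸ t)) (λ (A : Raw (suc (suc n)) q K) → RedAt t A)
    count-redAt {n} t c = IC-bij (IC-×Fin c (suc n ∸ t)) (λ Bj → ins t (proj₁ Bj) (toℕ (proj₂ Bj)))
      (λ { (B , j) cB → InsFacts.redAtA t B (toℕ j) (tj≤n j) cB })
      (λ { (B , j) (B' , j') cB cB' e → let (B≡ , j≡) = ins-inj t B B' (toℕ j) (toℕ j') (tj≤n j) (tj≤n j') cB cB' e
                                        in cong₂ _,_ B≡ (toℕ-injective j≡) })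
      (λ A redAtA → surj t A redAtA)
      where
      tj≤n : (j : Fin (suc n ∸ t)) → t + toℕ j ≤ n
      tj≤n j = ≤-pred (+-<-∸ (toℕ j) (suc n) t (toℕ<n j))

    module FromClean (N : ℕ → ℕ) (hN : ∀ p → IsCount (N p) (λ (A : Raw p q K) → Clean p A)) where
      open ClosedForm N

      clean-≡ : ∀ {p} {t t'} (A : Raw p q K) → t ≡ t' → Clean t A → Clean t' A
      clean-≡ A refl c = c

      clean-as-sum : ∀ {p} t {a b} → t < p → IsCount a (λ (A : Raw p q K) → Clean (suc t) A) →
        IsCount b (λ (A : Raw p q K) → RedAt t A) → IsCount (a + b) (λ (A : Raw p q K) → Clean t A)
      clean-as-sum t t<p cS cR = IC-⇔ (IC-⊎ cS cR (λ A → clean-suc-disjoint t A))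
        (λ A → either (clean-weaken t A) proj₁) (λ A → clean-split t t<p A)

      count-clean : ∀ d p → d ≤ p → IsCount (S d p) (λ (A : Raw p q K) → Clean (p ∸ d) A)
      count-clean zero p _ = IC-≡ (sym (S0 p)) (hN p)
      count-clean (suc zero) (suc p₀) _ =
        IC-≡ (trans (+-identityʳ _) (sym (S1 (suc p₀)))) (clean-as-sum p₀ (n<1+n p₀) (hN (suc p₀)) (none p₀))
        where
        none : ∀ p₀ → IsCount 0 (λ (A : Raw (suc p₀) q K) → RedAt p₀ A)
        none zero    = IC-empty (λ A → no-redAt-1 zero A)
        none (suc n) = IC-≡ (trans (cong (N n *_) (n∸n≡0 (suc n))) (*-zeroʳ (N n)))
          (count-redAt (suc n) (IC-⇔ (hN n) (λ A → clean-full (suc n) (n≤1+n n) A) (λ A → clean-restrict (suc n) (n≤1+n n) A)))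
      count-clean (suc (suc d')) (suc (suc n)) (s≤s (s≤s d'≤n)) =
        IC-≡ (sym (S-rec d' n)) (clean-as-sum (n ∸ d') (s≤s (≤-trans (m∸n≤m n d') (n≤1+n n)))
          (IC-⇔ (count-clean (suc d') (suc (suc n)) (s≤s (m≤n⇒m≤1+n d'≤n)))
                (λ A → clean-≡ A t+1≡) (λ A → clean-≡ A (sym t+1≡)))
          (IC-≡ (cong (S d' n *_) choices≡) (count-redAt (n ∸ d') (count-clean d' n d'≤n))))
        where
        t+1≡ : suc (suc n) ∸ suc d' ≡ suc (n ∸ d')
        t+1≡ = suc∸ n d' d'≤n
        -- the number of possible keys for the partner of the removed vertex
        choices≡ : suc n ∸ (n ∸ d') ≡ suc d'
        choices≡ = trans (suc∸ n (n ∸ d') (m∸n≤m n d')) (cong suc (m∸[m∸n]≡n d'≤n))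

      count-all : ∀ p → IsCount (S p p) (λ (A : Raw p q K) → Clean 0 A)
      count-all p = IC-⇔ (count-clean p p ≤-refl) (λ A → clean-≡ A (n∸n≡0 p)) (λ A → clean-≡ A (sym (n∸n≡0 p)))

module RowSwap where
  open Counting
  open PairExtension using (mapReaches)

  mixed-sym : ∀ {p q k} (A : Raw p q k) → (∀ v → partner A (partner A v) ≡ v) →
    ∣ tabulate (λ i → isRow2 (lookup (Raw.m1 A) i)) ∣ ≡ ∣ tabulate (λ j → isRow1 (lookup (Raw.m2 A) j)) ∣
  mixed-sym {p} {q} A inv = IC-unique (IC-bij count1 (partner A) to2 partner-inj from2) count2
    where
    Mixed1 Mixed2 : Vertex p q → Set
    Mixed1 v = Σ (Fin p) (λ i → v ≡ inj₁ i × isRow2 (partner A (inj₁ i)) ≡ true)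
    Mixed2 v = Σ (Fin q) (λ j → v ≡ inj₂ j × isRow1 (partner A (inj₂ j)) ≡ true)

    count1 : IsCount _ Mixed1
    count1 = IC-bij (IC-subset (λ i → isRow2 (lookup (Raw.m1 A) i))) inj₁ (λ i e → i , refl , e)
               (λ i i' _ _ → inj₁-injective) (λ { .(inj₁ i) (i , refl , e) → i , e , refl })

    count2 : IsCount _ Mixed2
    count2 = IC-bij (IC-subset (λ j → isRow1 (lookup (Raw.m2 A) j))) inj₂ (λ j e → j , refl , e)
               (λ j j' _ _ → inj₂-injective) (λ { .(inj₂ j) (j , refl , e) → j , e , refl })

    partner-inj : ∀ v v' → Mixed1 v → Mixed1 v' → partner A v ≡ partner A v' → v ≡ v'
    partner-inj v v' _ _ e = trans (sym (inv v)) (trans (cong (partner A) e) (inv v'))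

    to2 : ∀ v → Mixed1 v → Mixed2 (partner A v)
    to2 .(inj₁ i) (i , refl , e) with partner A (inj₁ i) in eq
    ... | inj₂ j = j , refl , cong isRow1 (trans (sym (cong (partner A) eq)) (inv (inj₁ i)))

    from2 : ∀ v → Mixed2 v → Σ (Vertex p q) (λ u → Mixed1 u × partner A u ≡ v)
    from2 .(inj₂ j) (j , refl , e) with partner A (inj₂ j) in eq
    ... | inj₁ i = inj₁ i , (i , refl , cong isRow2 (trans (sym (cong (partner A) eq)) (inv (inj₂ j)))) ,
                   trans (sym (cong (partner A) eq)) (inv (inj₂ j))

  swapV : ∀ {p q} → Vertex p q → Vertex q p
  swapV (inj₁ i) = inj₂ i
  swapV (inj₂ j) = inj₁ j

  swapV² : ∀ {p q} (v : Vertex p q) → swapV (swapV v) ≡ v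
  swapV² (inj₁ _) = refl
  swapV² (inj₂ _) = refl

  swapRaw : ∀ {p q k} → Raw p q k → Raw q p k
  swapRaw (mkRaw s1 s2 m1 m2 R R') = mkRaw s2 s1 (vmap swapV m2) (vmap swapV m1) R' R

  swap² : ∀ {p q k} (A : Raw p q k) → swapRaw (swapRaw A) ≡ A
  swap² (mkRaw s1 s2 m1 m2 R R') =
    cong₂ (λ x y → mkRaw s1 s2 x y R R')
      (trans (sym (map-∘ swapV swapV m1)) (trans (map-cong swapV² m1) (map-id m1)))
      (trans (sym (map-∘ swapV swapV m2)) (trans (map-cong swapV² m2) (map-id m2)))

  swap-inj : ∀ {p q k} (X Y : Raw p q k) → swapRaw X ≡ swapRaw Y → X ≡ Y
  swap-inj X Y e = trans (sym (swap² X)) (trans (cong swapRaw e) (swap² Y))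

  isRow2-swap : ∀ {p q} (v : Vertex p q) → isRow2 (swapV v) ≡ isRow1 v
  isRow2-swap (inj₁ _) = refl
  isRow2-swap (inj₂ _) = refl

  isRow1-swap : ∀ {p q} (v : Vertex p q) → isRow1 (swapV v) ≡ isRow2 v
  isRow1-swap (inj₁ _) = refl
  isRow1-swap (inj₂ _) = refl

  sameRow-unswap : ∀ {p q} (v w : Vertex p q) → SameRow (swapV v) (swapV w) → SameRow v w
  sameRow-unswap (inj₁ _) (inj₁ _) _ = refl
  sameRow-unswap (inj₂ _) (inj₂ _) _ = refl

  module Swapped {p q k : ℕ} (A : Raw p q k) where
    A' : Raw q p k
    A' = swapRaw A

    partner-swap : ∀ v → partner A' (swapV v) ≡ swapV (partner A v)
    partner-swap (inj₁ i) = lookup-map i swapV (Raw.m1 A)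
    partner-swap (inj₂ j) = lookup-map j swapV (Raw.m2 A)

    partner-swap' : ∀ v → partner A' v ≡ swapV (partner A (swapV v))
    partner-swap' v = trans (cong (partner A') (sym (swapV² v))) (partner-swap (swapV v))

    col-swap : ∀ u d → ColOf A u d → ColOf A' (swapV u) d
    col-swap (inj₁ i) d h = h
    col-swap (inj₂ j) d h = h

    arc1 : ∀ c d → Arc2 A c d → Arc1 A' c d
    arc1 c d (cn , j , rm , col) = cn , j , rm , subst (λ v → ColOf A' v d) (sym (partner-swap (inj₂ j))) (col-swap _ d col)

    arc2 : ∀ c d → Arc1 A c d → Arc2 A' c d
    arc2 c d (cn , i , rm , col) = cn , i , rm , subst (λ v → ColOf A' v d) (sym (partner-swap (inj₁ i))) (col-swap _ d col)

    paired : ∀ {s} → IsPairedArray p q s k A → IsPairedArray q p s k A'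
    paired {s} P = record
      { rowSum1 = rowSum2
      ; rowSum2 = rowSum1
      ; involutive = inv'
      ; noFixed = λ v e → noFixed (swapV v) (trans (sym (swapV² _)) (trans (cong swapV (sym (partner-swap' v))) (cong swapV e)))
      ; mixed = trans (cong ∣_∣ (tabulate-cong (λ j → mixed2 j))) (trans (sym (mixed-sym A involutive)) mixed)
      ; balance = λ c → trans (cong ∣_∣ (tabulate-cong (λ j → cong (inCellᵇ (Raw.sz2 A) j c ∧_) (mixed2 j))))
                  (trans (sym (balance c))
                    (cong ∣_∣ (tabulate-cong (λ i → cong (inCellᵇ (Raw.sz1 A) i c ∧_) (sym (mixed1 i))))))
      ; markedR = markedR'
      ; markedR' = markedR
      ; nonempty = λ c cn cn' → subst (1 ≤_) (+-comm (lookup (Raw.sz1 A) c) _) (nonempty c cn' cn)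
      ; forest1 = λ c h → mapReaches (λ _ x → x) arc1 c (forest2 c h)
      ; forest2 = λ c h → mapReaches (λ _ x → x) arc2 c (forest1 c h)
      }
      where
      open IsPairedArray P
      mixed2 : ∀ j → isRow2 (lookup (vmap swapV (Raw.m2 A)) j) ≡ isRow1 (lookup (Raw.m2 A) j)
      mixed2 j = trans (cong isRow2 (lookup-map j swapV (Raw.m2 A))) (isRow2-swap _)
      mixed1 : ∀ i → isRow1 (lookup (vmap swapV (Raw.m1 A)) i) ≡ isRow2 (lookup (Raw.m1 A) i)
      mixed1 i = trans (cong isRow1 (lookup-map i swapV (Raw.m1 A))) (isRow1-swap _)
      inv' : ∀ v → partner A' (partner A' v) ≡ v
      inv' v =
        begin
          partner A' (partner A' v)
        ≡⟨ partner-swap' (partner A' v) ⟩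
          swapV (partner A (swapV (partner A' v)))
        ≡⟨ cong (λ x → swapV (partner A (swapV x))) (partner-swap' v) ⟩
          swapV (partner A (swapV (swapV (partner A (swapV v)))))
        ≡⟨ cong (λ x → swapV (partner A x)) (swapV² (partner A (swapV v))) ⟩
          swapV (partner A (partner A (swapV v)))
        ≡⟨ cong swapV (involutive (swapV v)) ⟩
          swapV (swapV v)
        ≡⟨ swapV² v ⟩
          v
        ∎
        where open ≡-Reasoning

    canonical : ∀ {s} → Canonical p q s k A → Canonical q p s k A'
    canonical (P , r1 , r2) = paired P , r2 , r1

    ru→ : ∀ v → RightmostUnmarked A v → RightmostUnmarked A' (swapV v)
    ru→ (inj₁ i) h = h
    ru→ (inj₂ j) h = h

    red← : ∀ v → Redundant A' (swapV v) → Redundant A v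
    red← v (same , n1 , n2) = sameRow-unswap v _ (subst (SameRow (swapV v)) (partner-swap v) same) ,
                              (λ h → n1 (ru→ v h)) ,
                              (λ h → n2 (subst (RightmostUnmarked A') (sym (partner-swap v)) (ru→ _ h)))

open Counting
open Stages
open StageCount
open RowSwap
open Binomial

-- Both rows: remove the redundant row-1 pairs (arrays with rows as given),
-- then the redundant row-2 pairs (working on the row-swapped arrays).
module TwoRows (q s k' : ℕ) (m : ℕ → ℕ → ℕ)
               (hm : ∀ p' q' → IsCount (m p' q') (MinCanonical p' q' s (suc k'))) where
  K : ℕ
  K = suc k'

  -- Minimal canonical arrays are, after swapping the rows, the canonical
  -- arrays with no redundant pair in either row.
  count-min-swapped : ∀ p' q' → IsCount (m p' q') (λ (A : Raw q' p' K) → Filtration.Clean {p'} {k'} {s} true q' A)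
  count-min-swapped p' q' = IC-bij (hm p' q') swapRaw
    (λ B (cB , minB) → Swapped.canonical B cB ,
        (λ z _ red → minB (inj₂ z) (Swapped.red← B (inj₂ z) red)) ,
        (λ _ j red → minB (inj₁ j) (Swapped.red← B (inj₁ j) red)))
    (λ X Y _ _ → swap-inj X Y)
    (λ A (cA , nr , nr2) → swapRaw A ,
        (Swapped.canonical A cA ,
         λ { (inj₁ i) red → nr2 refl i (Swapped.red← A (inj₂ i) red)
           ; (inj₂ j) red → nr j (Filtration.key-bound-A {p'} {k'} {s} true A cA j) (Swapped.red← A (inj₁ j) red) }) ,
        swap² A)

  N1 : ℕ → ℕ
  N1 p' = ClosedForm.S (m p') q q

  count-row1-clean : ∀ p' → IsCount (N1 p') (λ (B : Raw p' q K) → Filtration.Clean {q} {k'} {s} false p' B)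
  count-row1-clean p' = IC-bij (Count.FromClean.count-all {p'} {k'} {s} true (m p') (count-min-swapped p') q) swapRaw
    (λ A (cA , _ , nr2) → Swapped.canonical A cA , (λ z _ red → nr2 refl z (Swapped.red← A (inj₂ z) red)) , (λ ()))
    (λ X Y _ _ → swap-inj X Y)
    (λ B (cB , nr , _) → swapRaw B ,
        (Swapped.canonical B cB , (λ z ()) ,
         (λ _ j red → nr j (Filtration.key-bound-A {q} {k'} {s} false B cB j) (Swapped.red← B (inj₁ j) red))) ,
        swap² B)

  count-canonical : ∀ p → IsCount (ClosedForm.S N1 p p) (Canonical p q s K)
  count-canonical p = IC-⇔ (Count.FromClean.count-all {q} {k'} {s} false N1 count-row1-clean p)
    (λ A → proj₁) (λ A cA → cA , (λ z ()) , (λ ()))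

  closed-form : ∀ p → ClosedForm.S N1 p p ≡ sumUpTo p (λ i → sumUpTo q (λ j →
    (p C (2 * i)) * dfact i * ((q C (2 * j)) * dfact j) * m (p ∸ 2 * i) (q ∸ 2 * j)))
  closed-form p = sym (trans (sumUpTo≡Σ< p _) (Σ<-cong (suc p) _ _ inner))
    where
    inner : ∀ i → sumUpTo q (λ j → (p C (2 * i)) * dfact i * ((q C (2 * j)) * dfact j) * m (p ∸ 2 * i) (q ∸ 2 * j))
                ≡ (p C (2 * i)) * dfact i * N1 (p ∸ 2 * i)
    inner i = trans (sumUpTo≡Σ< q _)
      (trans (Σ<-cong (suc q) _ _ (λ j → *-assoc ((p C (2 * i)) * dfact i) ((q C (2 * j)) * dfact j) (m (p ∸ 2 * i) (q ∸ 2 * j))))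
             (Σ<-* (suc q) ((p C (2 * i)) * dfact i) (λ j → (q C (2 * j)) * dfact j * m (p ∸ 2 * i) (q ∸ 2 * j))))

theorem3p1 : (p q s k : ℕ) → 1 ≤ p → 1 ≤ q → 1 ≤ s → 1 ≤ k
    → p % 2 ≡ q % 2 → q % 2 ≡ s % 2
    → (c : ℕ) → IsCount c (Canonical p q s k)
    → (m : ℕ → ℕ → ℕ) → (∀ p′ q′ → IsCount (m p′ q′) (MinCanonical p′ q′ s k))
    → c ≡ sumUpTo p (λ i → sumUpTo q (λ j →
            (p C (2 * i)) * dfact i * ((q C (2 * j)) * dfact j) * m (p ∸ 2 * i) (q ∸ 2 * j)))
theorem3p1 p q s (suc k') _ _ _ _ _ _ c hc m hm =
  trans (IC-unique hc (count-canonical p)) (closed-form p)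
  where open TwoRows q s k' m hm
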